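{- Let $S$ be a finite totally ordered set, $R$ a commutative ring with $1$, $q\in R$, $A=R\langle t_s\mid s\in S\rangle$, $J\subseteq S$ and $s\in S$. Write $f\to g$ for "$f$ reduces to $g$ modulo $\mathcal{G}_q(\emptyset)=\{t_r^2-q\ (r\in S),\ t_rt_p+t_pt_r-2q\ (p<r)\}$". (1) If $s\in J$, then $t^+_Jt_s\to(-1)^{\#J+1}q\,t^-_J$ and $t^-_Jt_s\to(-1)^{\#J+1}t^+_J$. (2) If $s\notin J$, let $J''=\{j\in J\mid s<j\}$. Then $t^+_Jt_s\to(-1)^{\#J''}t^+_{J\cup\{s\}}+(-1)^{\#J+1}q\,t^-_J$ and $t^-_Jt_s\to(-1)^{\#J''}t^-_{J\cup\{s\}}+(-1)^{\#J+1}t^+_J$.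
   Context: For $J=\{j_1<\dots<j_{\#J}\}$, $t_J=t_{j_1}\cdots t_{j_{\#J}}$; for $I=\{j_{\alpha_1}<\dots<j_{\alpha_{\#I}}\}\subseteq J$, $\ell_J(I)=\sum_\nu(\alpha_\nu-\nu)$; $t^-_J=\sum_{I\subseteq J,\ \#I\text{ odd}}(-1)^{\ell_J(I)}(-q)^{(\#I-1)/2}t_{J\setminus I}$, $t^+_J=\sum_{I\subseteq J,\ \#I\text{ even}}(-1)^{\ell_J(I)}(-q)^{\#I/2}t_{J\setminus I}$. Monomials are ordered by deglex (shorter first, equal length compared lexicographically); the leading monomial of $t_r^2-q$ is $t_r^2$ and of $t_rt_p+t_pt_r-2q$ ($p<r$) is $t_rt_p$. A reduction of $f$ modulo a set $\mathcal{I}$ of polynomials with leading coefficient $1$ replaces, in some term $c\,u\,m\,v$ of $f$ with $m$ the leading monomial of some $g\in\mathcal{I}$, the subword $m$ by $m-g$; $f$ reduces to $h$ if a finite (possibly empty) sequence of reductions leads from $f$ to $h$. -}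

module Defs where

open import Level using (_⊔_)
open import Algebra.Bundles using (CommutativeRing)
open import Data.Nat as ℕ using (ℕ; zero; suc; ⌊_/2⌋) renaming (_+_ to _+ℕ_; _∸_ to _∸ℕ_)
open import Data.Bool using (Bool; true; false; if_then_else_)
open import Data.Fin using (Fin; zero; suc) renaming (_<_ to _<F_; _≟_ to _≟F_; _<?_ to _<F?_)
open import Data.List.Properties using (≡-dec)
open import Relation.Nullary.Decidable using (⌊_⌋)
open import Data.Fin.Subset using (Subset)
open import Data.List using (List; []; _∷_; _++_; map; concatMap; length; foldr; filter)
open import Data.Product using (_×_; _,_; Σ; ∃)
open import Data.Vec using ([]; _∷_)
open import Relation.Binary.Construct.Closure.ReflexiveTransitive using (Star)

elems : ∀ {n} → Subset n → List (Fin n)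
elems [] = []
elems (true ∷ p) = zero ∷ map suc (elems p)
elems (false ∷ p) = map suc (elems p)

-- All Boolean selection lists of a given length: the subsets I of a list J.
selections : ℕ → List (List Bool)
selections zero = [] ∷ []
selections (suc k) = concatMap (λ bs → (true ∷ bs) ∷ (false ∷ bs) ∷ []) (selections k)

unselected : ∀ {A : Set} → List Bool → List A → List A
unselected (false ∷ bs) (x ∷ xs) = x ∷ unselected bs xs
unselected (true ∷ bs) (x ∷ xs) = unselected bs xs
unselected _ _ = []

countTrue : List Bool → ℕ
countTrue [] = 0
countTrue (true ∷ bs) = suc (countTrue bs)
countTrue (false ∷ bs) = countTrue bs

-- positions (1-based, starting at the given offset) of the selected elements: α₁ < α₂ < …
positions : ℕ → List Bool → List ℕ
positions k [] = []
positions k (true ∷ bs) = k ∷ positions (suc k) bs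
positions k (false ∷ bs) = positions (suc k) bs

ℓsum : ℕ → List ℕ → ℕ
ℓsum ν [] = 0
ℓsum ν (α ∷ αs) = (α ∸ℕ ν) +ℕ ℓsum (suc ν) αs

ℓ : List Bool → ℕ
ℓ bs = ℓsum 1 (positions 1 bs)

odd : ℕ → Bool
odd zero = false
odd (suc k) = if odd k then false else true

module Alg {c ℓr} (R : CommutativeRing c ℓr) (n : ℕ) (q : CommutativeRing.Carrier R) where
  open CommutativeRing R

  -- monomials: words in the variables t_s, s ∈ Fin n (S = Fin n with its natural order)
  Word : Set
  Word = List (Fin n)

  -- polynomials of A = R⟨t_s | s ∈ S⟩ as formal finite R-linear combinations of words
  Poly : Set c
  Poly = List (Carrier × Word)

  coeff : Poly → Word → Carrier
  coeff [] w = 0#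
  coeff ((a , u) ∷ f) w = (if ⌊ ≡-dec _≟F_ u w ⌋ then a else 0#) + coeff f w

  _≋_ : Poly → Poly → Set ℓr
  f ≋ g = ∀ w → coeff f w ≈ coeff g w

  infixl 6 _⊕_ _⊖_
  infixl 7 _⊛_ _·_
  infix 4 _⟶*_ _≋_
  infixr 8 _^_

  _⊕_ : Poly → Poly → Poly
  f ⊕ g = f ++ g

  _·_ : Carrier → Poly → Poly
  a · f = map (λ { (b , u) → (a * b , u) }) f

  _⊖_ : Poly → Poly → Poly
  f ⊖ g = f ⊕ ((- 1#) · g)

  _⊛_ : Poly → Poly → Poly
  f ⊛ g = concatMap (λ { (a , u) → map (λ { (b , v) → (a * b , u ++ v) }) g }) f

  mono : Word → Poly
  mono u = (1# , u) ∷ []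

  var : Fin n → Poly
  var s = mono (s ∷ [])

  _^_ : Carrier → ℕ → Carrier
  a ^ zero = 1#
  a ^ suc k = a * (a ^ k)

  data Gen : Set where
    sq   : (r : Fin n) → Gen
    anti : (p r : Fin n) → p <F r → Gen

  gen : Gen → Poly
  gen (sq r) = mono (r ∷ r ∷ []) ⊖ (q · mono [])
  gen (anti p r _) = mono (r ∷ p ∷ []) ⊕ mono (p ∷ r ∷ []) ⊖ ((1# + 1#) * q) · mono []

  -- leading monomial (deglex); leading coefficient is 1
  lm : Gen → Word
  lm (sq r) = r ∷ r ∷ []
  lm (anti p r _) = r ∷ p ∷ []

  -- one reduction step: in the term c·u·m·v of f (c the coefficient of the word u m v in f),
  -- replace m by m - g; i.e. f ↦ f - c·u·g·v
  data Step (f h : Poly) : Set (c ⊔ ℓr) where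
    step : (u v : Word) (g : Gen) →
           h ≋ (f ⊖ coeff f (u ++ lm g ++ v) · (mono u ⊛ gen g ⊛ mono v)) →
           Step f h

  _⟶*_ : Poly → Poly → Set (c ⊔ ℓr)
  f ⟶* h = Σ Poly (λ h′ → Star Step f h′ × h′ ≋ h)

  tL : List (Fin n) → Poly
  tL js = mono js

  t : Subset n → Poly
  t J = tL (elems J)

  Σsel : List (List Bool) → (List Bool → Poly) → Poly
  Σsel bss F = concatMap F bss

  t⁻ : Subset n → Poly
  t⁻ J = Σsel (selections (length js)) λ bs →
           if odd (countTrue bs)
           then ((((- 1#) ^ ℓ bs) * ((- q) ^ ⌊ countTrue bs ∸ℕ 1 /2⌋)) · tL (unselected bs js))
           else []
    where js = elems J

  t⁺ : Subset n → Poly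
  t⁺ J = Σsel (selections (length js)) λ bs →
           if odd (countTrue bs)
           then []
           else ((((- 1#) ^ ℓ bs) * ((- q) ^ ⌊ countTrue bs /2⌋)) · tL (unselected bs js))
    where js = elems J

  #above : Fin n → Subset n → ℕ
  #above s J = length (filter (s <F?_) (elems J))

-- Write J as its increasing list of elements js; then t^±_J = T^±(js), and
-- splitting off the first letter x gives  T⁺(x∷xs) = x T⁺(xs) - q T⁻(xs)  and
-- T⁻(x∷xs) = T⁺(xs) - x T⁻(xs).  Induction on js moves t_s to the left: letters
-- x < s are split off by these recurrences (cons-step); once the first letter
-- exceeds s, t_s passes all of js by t_x t_s → -t_s t_x + 2q (move-past); at the
-- letter s it passes the larger ones and is absorbed by t_s t_s → q.  Each use of
-- a rule rewrites a whole polynomial, one word at a time (the layer lemma).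
-- Since a step subtracts the full coefficient of its redex, reductions record
-- the words they reduce, which lets reductions of summands be combined (red-⊕).

module Submission where

open import Defs
open import Level using (Level; _⊔_; 0ℓ)
open import Algebra.Bundles using (CommutativeRing)
open import Data.Nat as ℕ using (ℕ; zero; suc; ⌊_/2⌋; _≤_; z≤n; s≤s) renaming (_+_ to _+ℕ_; _∸_ to _∸ℕ_)
import Data.Nat.Properties as ℕP
open import Algebra.Properties.CommutativeSemigroup ℕP.+-commutativeSemigroup using () renaming (x∙yz≈y∙xz to ℕ-x+[y+z]≡y+[x+z])
open import Data.Bool using (Bool; true; false; if_then_else_)
open import Data.Fin using (Fin; zero; suc; _<_; _<?_) renaming (_≟_ to _≟F_)
import Data.Fin.Properties as FinP
open import Data.List using (List; []; _∷_; _++_; map; concatMap; length; filter)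
import Data.List.Properties as LP
open import Data.List.Relation.Unary.All as All using (All; []; _∷_)
import Data.List.Relation.Unary.All.Properties as AllP
open import Data.List.Relation.Unary.Any using (here; there)
open import Data.List.Relation.Unary.AllPairs using (AllPairs; []; _∷_)
open import Data.List.Relation.Binary.Pointwise using (Pointwise; []; _∷_)
open import Data.Product using (_×_; _,_; Σ; proj₁; proj₂)
open import Data.Sum using (_⊎_; inj₁; inj₂; [_,_])
open import Data.Empty using (⊥-elim)
open import Relation.Nullary using (¬_; yes; no)
open import Relation.Nullary.Decidable using (⌊_⌋)
open import Relation.Unary using (Pred; _⊆_) renaming (_∪_ to _∪ᵖ_)
open import Relation.Binary.Definitions using (tri<; tri≈; tri>)
open import Relation.Binary.PropositionalEquality as ≡ using (_≡_; _≢_)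
open import Relation.Binary.Construct.Closure.ReflexiveTransitive using (Star; ε; _◅_; _◅◅_; gmap)

-- The canonical ring homomorphism ℤ → R, packaged so that the standard
-- library's ring solver can be used in R with integer coefficients.
module IntegerSolver {c ℓ} (R : CommutativeRing c ℓ) where
  open import Data.Integer as ℤ using (ℤ; +_; -[1+_]; sign; ∣_∣; _◃_)
  import Data.Integer.Properties as ℤP
  open import Data.Sign as Sign using (Sign)
  open import Data.Maybe using (Maybe; just; nothing)
  import Algebra.Solver.Ring.AlmostCommutativeRing as ACR
  open CommutativeRing R
  open import Relation.Binary.Reasoning.Setoid setoid
  open import Algebra.Properties.AbelianGroup +-abelianGroup using (⁻¹-∙-comm)
  open import Algebra.Properties.Group +-group using (ε⁻¹≈ε; ⁻¹-involutive)
  open import Algebra.Properties.Ring ring using (-1*x≈-x)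
  open import Algebra.Properties.CommutativeSemigroup *-commutativeSemigroup using (interchange)
  open import Algebra.Properties.Semiring.Mult.TCOptimised semiring
    using (1+×; ×-homo-+; ×1-homo-*) renaming (_×_ to _×′_)

  ι : ℕ → Carrier
  ι m = m ×′ 1#

  ⟦_⟧ℤ : ℤ → Carrier
  ⟦ + m ⟧ℤ = ι m
  ⟦ -[1+ m ] ⟧ℤ = - ι (suc m)

  ⊖-homo : ∀ m k → ⟦ m ℤ.⊖ k ⟧ℤ ≈ ι m + - ι k
  ⊖-homo zero zero = sym (trans (+-congˡ ε⁻¹≈ε) (+-identityʳ _))
  ⊖-homo zero (suc k) = sym (+-identityˡ _)
  ⊖-homo (suc m) zero = sym (trans (+-congˡ ε⁻¹≈ε) (+-identityʳ _))
  ⊖-homo (suc m) (suc k) = begin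
    ⟦ suc m ℤ.⊖ suc k ⟧ℤ           ≡⟨ ≡.cong ⟦_⟧ℤ (ℤP.[1+m]⊖[1+n]≡m⊖n m k) ⟩
    ⟦ m ℤ.⊖ k ⟧ℤ                   ≈⟨ ⊖-homo m k ⟩
    ι m + - ι k                    ≈⟨ +-congʳ (sym (+-identityˡ _)) ⟩
    (0# + ι m) + - ι k             ≈⟨ +-congʳ (+-congʳ (sym (-‿inverseʳ 1#))) ⟩
    ((1# + - 1#) + ι m) + - ι k    ≈⟨ +-congʳ (trans (+-assoc _ _ _) (trans (+-congˡ (+-comm _ _)) (sym (+-assoc _ _ _)))) ⟩
    ((1# + ι m) + - 1#) + - ι k    ≈⟨ +-assoc _ _ _ ⟩
    (1# + ι m) + (- 1# + - ι k)    ≈⟨ +-cong (sym (1+× m 1#)) (⁻¹-∙-comm _ _) ⟩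
    ι (suc m) + - (1# + ι k)       ≈⟨ +-congˡ (-‿cong (sym (1+× k 1#))) ⟩
    ι (suc m) + - ι (suc k)        ∎

  signed : Sign → Carrier
  signed Sign.+ = 1#
  signed Sign.- = - 1#

  ◃-homo : ∀ σ m → ⟦ σ ◃ m ⟧ℤ ≈ signed σ * ι m
  ◃-homo σ zero = sym (zeroʳ _)
  ◃-homo Sign.+ (suc m) = sym (*-identityˡ _)
  ◃-homo Sign.- (suc m) = sym (-1*x≈-x _)

  signed-* : ∀ σ τ → signed (σ Sign.* τ) ≈ signed σ * signed τ
  signed-* Sign.+ τ = sym (*-identityˡ _)
  signed-* Sign.- Sign.+ = sym (*-identityʳ _)
  signed-* Sign.- Sign.- = sym (trans (-1*x≈-x _) (⁻¹-involutive _))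

  sign-abs : ∀ i → ⟦ i ⟧ℤ ≈ signed (sign i) * ι ∣ i ∣
  sign-abs i = trans (reflexive (≡.cong ⟦_⟧ℤ (≡.sym (ℤP.◃-inverse i)))) (◃-homo (sign i) ∣ i ∣)

  *-homo : ∀ i j → ⟦ i ℤ.* j ⟧ℤ ≈ ⟦ i ⟧ℤ * ⟦ j ⟧ℤ
  *-homo i j = begin
    ⟦ i ℤ.* j ⟧ℤ                                        ≈⟨ ◃-homo (sign i Sign.* sign j) (∣ i ∣ ℕ.* ∣ j ∣) ⟩
    signed (sign i Sign.* sign j) * ι (∣ i ∣ ℕ.* ∣ j ∣)  ≈⟨ *-cong (signed-* (sign i) (sign j)) (×1-homo-* ∣ i ∣ ∣ j ∣) ⟩
    (signed (sign i) * signed (sign j)) * (ι ∣ i ∣ * ι ∣ j ∣) ≈⟨ interchange _ _ _ _ ⟩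
    (signed (sign i) * ι ∣ i ∣) * (signed (sign j) * ι ∣ j ∣) ≈⟨ sym (*-cong (sign-abs i) (sign-abs j)) ⟩
    ⟦ i ⟧ℤ * ⟦ j ⟧ℤ                                     ∎

  +-homo : ∀ i j → ⟦ i ℤ.+ j ⟧ℤ ≈ ⟦ i ⟧ℤ + ⟦ j ⟧ℤ
  +-homo (+ m) (+ k) = ×-homo-+ 1# m k
  +-homo (+ m) -[1+ k ] = ⊖-homo m (suc k)
  +-homo -[1+ m ] (+ k) = trans (⊖-homo k (suc m)) (+-comm _ _)
  +-homo -[1+ m ] -[1+ k ] = begin
    - ι (suc (suc (m ℕ.+ k)))      ≈⟨ -‿cong (1+× (suc (m ℕ.+ k)) 1#) ⟩
    - (1# + ι (suc m ℕ.+ k))       ≈⟨ -‿cong (+-congˡ (×-homo-+ 1# (suc m) k)) ⟩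
    - (1# + (ι (suc m) + ι k))     ≈⟨ -‿cong (trans (sym (+-assoc _ _ _)) (trans (+-congʳ (+-comm _ _)) (+-assoc _ _ _))) ⟩
    - (ι (suc m) + (1# + ι k))     ≈⟨ -‿cong (+-congˡ (sym (1+× k 1#))) ⟩
    - (ι (suc m) + ι (suc k))      ≈⟨ sym (⁻¹-∙-comm _ _) ⟩
    - ι (suc m) + - ι (suc k)      ∎

  -‿homo : ∀ i → ⟦ ℤ.- i ⟧ℤ ≈ - ⟦ i ⟧ℤ
  -‿homo (+ zero) = sym ε⁻¹≈ε
  -‿homo (+ suc m) = refl
  -‿homo -[1+ m ] = sym (⁻¹-involutive _)

  homomorphism : CommutativeRing.rawRing ℤP.+-*-commutativeRing ACR.-Raw-AlmostCommutative⟶ ACR.fromCommutativeRing R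
  homomorphism = record
    { ⟦_⟧ = ⟦_⟧ℤ ; +-homo = +-homo ; *-homo = *-homo ; -‿homo = -‿homo
    ; 0-homo = refl ; 1-homo = refl }

  ≟-coefficients : ∀ i j → Maybe (⟦ i ⟧ℤ ≈ ⟦ j ⟧ℤ)
  ≟-coefficients i j with i ℤ.≟ j
  ... | yes ≡.refl = just refl
  ... | no _ = nothing

  open import Algebra.Solver.Ring _ _ homomorphism ≟-coefficients public

  :zero :one :-one :two : ∀ {m} → Polynomial m
  :zero = con (ℤ.+ 0)
  :one = con (ℤ.+ 1)
  :-one = :- :one
  :two = :one :+ :one

module Polynomials {c ℓ} (R : CommutativeRing c ℓ) (n : ℕ) (q : CommutativeRing.Carrier R) where
  open CommutativeRing R
  open Alg R n q
  open IntegerSolver R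

  -- Equality in A (_≋_), wrapped in a record so that both polynomials
  -- can be recovered from the type by unification.
  infix 4 _≃_
  record _≃_ (f g : Poly) : Set ℓ where
    constructor ⟪_⟫
    field un : f ≋ g
  open _≃_ public

  ≃-refl : ∀ {f} → f ≃ f
  ≃-refl = ⟪ (λ _ → refl) ⟫

  ≃-sym : ∀ {f g} → f ≃ g → g ≃ f
  ≃-sym e = ⟪ (λ w → sym (un e w)) ⟫

  ≃-trans : ∀ {f g h} → f ≃ g → g ≃ h → f ≃ h
  ≃-trans e e' = ⟪ (λ w → trans (un e w) (un e' w)) ⟫

  ≡⇒≃ : ∀ {f g} → f ≡ g → f ≃ g
  ≡⇒≃ ≡.refl = ≃-refl

  _==_ : Word → Word → Bool
  u == w = ⌊ LP.≡-dec _≟F_ u w ⌋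

  ==-refl : ∀ w → (w == w) ≡ true
  ==-refl w with LP.≡-dec _≟F_ w w
  ... | yes _ = ≡.refl
  ... | no w≢w = ⊥-elim (w≢w ≡.refl)

  ==-≢ : ∀ {u w} → u ≢ w → (u == w) ≡ false
  ==-≢ {u} {w} u≢w with LP.≡-dec _≟F_ u w
  ... | yes u≡w = ⊥-elim (u≢w u≡w)
  ... | no _ = ≡.refl

  coeff-⊕ : ∀ f g w → coeff (f ⊕ g) w ≈ coeff f w + coeff g w
  coeff-⊕ [] g w = sym (+-identityˡ _)
  coeff-⊕ ((a , u) ∷ f) g w = trans (+-congˡ (coeff-⊕ f g w)) (sym (+-assoc _ _ _))

  coeff-· : ∀ a f w → coeff (a · f) w ≈ a * coeff f w
  coeff-· a [] w = sym (zeroʳ _)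
  coeff-· a ((b , u) ∷ f) w with u == w
  ... | true = trans (+-congˡ (coeff-· a f w)) (sym (distribˡ _ _ _))
  ... | false = trans (+-cong (sym (zeroʳ _)) (coeff-· a f w)) (sym (distribˡ _ _ _))

  coeff-mono-≢ : ∀ {u w} → u ≢ w → coeff (mono u) w ≈ 0#
  coeff-mono-≢ u≢w rewrite ==-≢ u≢w = +-identityʳ _

  c+ : ∀ f g {w A B} → coeff f w ≈ A → coeff g w ≈ B → coeff (f ⊕ g) w ≈ A + B
  c+ f g {w} e e' = trans (coeff-⊕ f g w) (+-cong e e')

  c* : ∀ a f {w A} → coeff f w ≈ A → coeff (a · f) w ≈ a * A
  c* a f {w} e = trans (coeff-· a f w) (*-congˡ e)

  c- : ∀ f g {w A B} → coeff f w ≈ A → coeff g w ≈ B → coeff (f ⊖ g) w ≈ A + (- 1#) * B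
  c- f g e e' = c+ f _ e (c* (- 1#) g e')

  c≃ : ∀ {f g w A} → f ≃ g → coeff g w ≈ A → coeff f w ≈ A
  c≃ {w = w} e e' = trans (un e w) e'

  c0+ : ∀ f g {w} → coeff f w ≈ 0# → coeff g w ≈ 0# → coeff (f ⊕ g) w ≈ 0#
  c0+ f g e e' = trans (c+ f g e e') (+-identityʳ 0#)

  c0* : ∀ a f {w} → coeff f w ≈ 0# → coeff (a · f) w ≈ 0#
  c0* a f e = trans (c* a f e) (zeroʳ a)

  coeff-lin : ∀ a f b g w → coeff (a · f ⊕ b · g) w ≈ a * coeff f w + b * coeff g w
  coeff-lin a f b g w = c+ (a · f) (b · g) (coeff-· a f w) (coeff-· b g w)

  ⊕-cong : ∀ {f f′ g g′} → f ≃ f′ → g ≃ g′ → f ⊕ g ≃ f′ ⊕ g′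
  ⊕-cong {f} {f′} {g} {g′} e e′ = ⟪ (λ w → trans (c+ f g (un e w) (un e′ w)) (sym (coeff-⊕ f′ g′ w))) ⟫

  ·-cong : ∀ {a b f g} → a ≈ b → f ≃ g → a · f ≃ b · g
  ·-cong {a} {b} {f} {g} a≈b e = ⟪ (λ w → trans (c* a f (un e w)) (trans (*-congʳ a≈b) (sym (coeff-· b g w)))) ⟫

  ·-congˡ : ∀ {a b} f → a ≈ b → a · f ≃ b · f
  ·-congˡ f a≈b = ·-cong a≈b (≃-refl {f})

  ⊖-cong : ∀ {f f′ g g′} → f ≃ f′ → g ≃ g′ → f ⊖ g ≃ f′ ⊖ g′
  ⊖-cong e e′ = ⊕-cong e (·-cong refl e′)

  ⊕-comm : ∀ f g → f ⊕ g ≃ g ⊕ f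
  ⊕-comm f g = ⟪ (λ w → trans (coeff-⊕ f g w) (trans (+-comm _ _) (sym (coeff-⊕ g f w)))) ⟫

  ⊕-assoc : ∀ f g h → (f ⊕ g) ⊕ h ≡ f ⊕ (g ⊕ h)
  ⊕-assoc = LP.++-assoc

  ·-⊕ : ∀ a f g → a · (f ⊕ g) ≡ a · f ⊕ a · g
  ·-⊕ a = LP.map-++ _

  Pw : Poly → Poly → Set _
  Pw = Pointwise (λ s t → (proj₁ s ≈ proj₁ t) × (proj₂ s ≡ proj₂ t))

  Pw⇒≃ : ∀ {f g} → Pw f g → f ≃ g
  Pw⇒≃ ps = ⟪ go ps ⟫
    where
    go : ∀ {f g} → Pw f g → f ≋ g
    go [] w = refl
    go {(a , u) ∷ f} ((a≈b , ≡.refl) ∷ ps) w with u == w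
    ... | true = +-cong a≈b (go ps w)
    ... | false = +-congˡ (go ps w)

  ·-assoc : ∀ a b f → a · (b · f) ≃ (a * b) · f
  ·-assoc a b f = Pw⇒≃ (go f)
    where
    go : ∀ f → Pw (a · (b · f)) ((a * b) · f)
    go [] = []
    go ((x , w) ∷ f) = (sym (*-assoc a b x) , ≡.refl) ∷ go f

  ·-comm : ∀ a b f → a · (b · f) ≃ b · (a · f)
  ·-comm a b f = ≃-trans (·-assoc a b f) (≃-trans (·-congˡ f (*-comm a b)) (≃-sym (·-assoc b a f)))

  ⊖-⊕ : ∀ f a g k → (f ⊖ a · g) ⊕ k ≃ (f ⊕ k) ⊖ a · g
  ⊖-⊕ f a g k = ⟪ (λ w → trans (c+ (f ⊖ a · g) k (c- f (a · g) refl (coeff-· a g w)) refl)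
                  (trans (solve 4 (λ F A G K → (F :+ :-one :* (A :* G)) :+ K
                                             := (F :+ K) :+ :-one :* (A :* G))
                                  refl (coeff f w) a (coeff g w) (coeff k w))
                  (sym (c- (f ⊕ k) (a · g) (coeff-⊕ f k w) (coeff-· a g w))))) ⟫

  ·-⊖ : ∀ a f b g → a · (f ⊖ b · g) ≃ a · f ⊖ (a * b) · g
  ·-⊖ a f b g = ⟪ (λ w → trans (c* a (f ⊖ b · g) (c- f (b · g) refl (coeff-· b g w)))
                  (trans (solve 4 (λ A F B G → A :* (F :+ :-one :* (B :* G))
                                             := A :* F :+ :-one :* ((A :* B) :* G))
                                  refl a (coeff f w) b (coeff g w))
                  (sym (c- (a · f) ((a * b) · g) (coeff-· a f w) (coeff-· (a * b) g w))))) ⟫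

  -- Applying a map φ to every word of a polynomial; for φ injective with
  -- decidable image this is a well-defined linear map of A.
  mapW : (Word → Word) → Poly → Poly
  mapW φ = map (λ { (b , u) → (b , φ u) })

  Injective : (Word → Word) → Set
  Injective φ = ∀ {u v} → φ u ≡ φ v → u ≡ v

  DecidableImage : (Word → Word) → Set
  DecidableImage φ = ∀ w → (Σ Word λ u → φ u ≡ w) ⊎ (∀ u → φ u ≢ w)

  coeff-mapW-image : ∀ φ → Injective φ → ∀ f w → coeff (mapW φ f) (φ w) ≈ coeff f w
  coeff-mapW-image φ inj [] w = refl
  coeff-mapW-image φ inj ((b , u) ∷ f) w with LP.≡-dec _≟F_ (φ u) (φ w) | LP.≡-dec _≟F_ u w
  ... | yes _ | yes _ = +-congˡ (coeff-mapW-image φ inj f w)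
  ... | yes φu≡φw | no u≢w = ⊥-elim (u≢w (inj φu≡φw))
  ... | no φu≢φw | yes u≡w = ⊥-elim (φu≢φw (≡.cong φ u≡w))
  ... | no _ | no _ = +-congˡ (coeff-mapW-image φ inj f w)

  coeff-mapW-outside : ∀ φ f w → (∀ u → φ u ≢ w) → coeff (mapW φ f) w ≈ 0#
  coeff-mapW-outside φ [] w out = refl
  coeff-mapW-outside φ ((b , u) ∷ f) w out rewrite ==-≢ (out u) =
    trans (+-identityˡ _) (coeff-mapW-outside φ f w out)

  mapW-cong : ∀ φ → Injective φ → DecidableImage φ → ∀ {f g} → f ≃ g → mapW φ f ≃ mapW φ g
  mapW-cong φ inj dec {f} {g} e = ⟪ go ⟫
    where
    go : ∀ w → coeff (mapW φ f) w ≈ coeff (mapW φ g) w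
    go w with dec w
    ... | inj₁ (u , ≡.refl) = trans (coeff-mapW-image φ inj f u) (trans (un e u) (sym (coeff-mapW-image φ inj g u)))
    ... | inj₂ out = trans (coeff-mapW-outside φ f w out) (sym (coeff-mapW-outside φ g w out))

  mapW-⊕ : ∀ φ f g → mapW φ (f ⊕ g) ≡ mapW φ f ⊕ mapW φ g
  mapW-⊕ φ = LP.map-++ _

  mapW-· : ∀ φ a f → mapW φ (a · f) ≡ a · mapW φ f
  mapW-· φ a [] = ≡.refl
  mapW-· φ a ((b , u) ∷ f) = ≡.cong ((a * b , φ u) ∷_) (mapW-· φ a f)

  mapW-∘ : ∀ φ ψ f → mapW φ (mapW ψ f) ≡ mapW (λ w → φ (ψ w)) f
  mapW-∘ φ ψ [] = ≡.refl
  mapW-∘ φ ψ ((b , u) ∷ f) = ≡.cong ((b , φ (ψ u)) ∷_) (mapW-∘ φ ψ f)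

  mapW-lin : ∀ φ a f b g → mapW φ (a · f ⊕ b · g) ≡ a · mapW φ f ⊕ b · mapW φ g
  mapW-lin φ a f b g = ≡.trans (mapW-⊕ φ (a · f) (b · g)) (≡.cong₂ _⊕_ (mapW-· φ a f) (mapW-· φ b g))

  mapW-⊖ : ∀ φ f b g → mapW φ (f ⊖ b · g) ≡ mapW φ f ⊖ b · mapW φ g
  mapW-⊖ φ f b g = ≡.trans (mapW-⊕ φ f _)
    (≡.cong (mapW φ f ⊕_) (≡.trans (mapW-· φ (- 1#) _) (≡.cong ((- 1#) ·_) (mapW-· φ b g))))

  pre : Word → Poly → Poly
  pre u = mapW (u ++_)

  suf : Word → Poly → Poly
  suf v = mapW (_++ v)

  pre-image : ∀ u w → (Σ Word λ a → u ++ a ≡ w) ⊎ (∀ a → u ++ a ≢ w)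
  pre-image [] w = inj₁ (w , ≡.refl)
  pre-image (x ∷ u) [] = inj₂ (λ a ())
  pre-image (x ∷ u) (y ∷ w) with x ≟F y | pre-image u w
  ... | yes ≡.refl | inj₁ (a , e) = inj₁ (a , ≡.cong (x ∷_) e)
  ... | yes ≡.refl | inj₂ out = inj₂ (λ a e → out a (LP.∷-injectiveʳ e))
  ... | no x≢y | _ = inj₂ (λ a e → x≢y (LP.∷-injectiveˡ e))

  suf-image : ∀ v w → (Σ Word λ a → a ++ v ≡ w) ⊎ (∀ a → a ++ v ≢ w)
  suf-image v w with LP.≡-dec _≟F_ v w
  ... | yes e = inj₁ ([] , e)
  suf-image v [] | no v≢[] = inj₂ out
    where
    out : ∀ a → a ++ v ≢ []
    out [] e = v≢[] e
    out (x ∷ a) ()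
  suf-image v (y ∷ w) | no v≢yw with suf-image v w
  ... | inj₁ (a , e) = inj₁ (y ∷ a , ≡.cong (y ∷_) e)
  ... | inj₂ out = inj₂ out′
    where
    out′ : ∀ a → a ++ v ≢ y ∷ w
    out′ [] e = v≢yw e
    out′ (x ∷ a) e = out a (LP.∷-injectiveʳ e)

  pre-cong : ∀ u {f g} → f ≃ g → pre u f ≃ pre u g
  pre-cong u = mapW-cong (u ++_) (LP.++-cancelˡ u _ _) (pre-image u)

  suf-cong : ∀ v {f g} → f ≃ g → suf v f ≃ suf v g
  suf-cong v = mapW-cong (_++ v) (LP.++-cancelʳ v _ _) (suf-image v)

  coeff-pre : ∀ u f w → coeff (pre u f) (u ++ w) ≈ coeff f w
  coeff-pre u = coeff-mapW-image (u ++_) (LP.++-cancelˡ u _ _)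

  coeff-pre-outside : ∀ u f w → (∀ a → u ++ a ≢ w) → coeff (pre u f) w ≈ 0#
  coeff-pre-outside u = coeff-mapW-outside (u ++_)

  coeff-pre-head : ∀ {x y} f w → x ≢ y → coeff (pre (x ∷ []) f) (y ∷ w) ≈ 0#
  coeff-pre-head f w x≢y = coeff-pre-outside _ f _ (λ a e → x≢y (LP.∷-injectiveˡ e))

  pre-pre : ∀ x u f → pre (x ∷ []) (pre u f) ≡ pre (x ∷ u) f
  pre-pre x u = mapW-∘ ((x ∷ []) ++_) (u ++_)

  suf-pre : ∀ v x f → suf v (pre (x ∷ []) f) ≡ pre (x ∷ []) (suf v f)
  suf-pre v x f = ≡.trans (mapW-∘ (_++ v) ((x ∷ []) ++_) f) (≡.sym (mapW-∘ ((x ∷ []) ++_) (_++ v) f))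

  mono⊛ : ∀ u f → mono u ⊛ f ≃ pre u f
  mono⊛ u f = Pw⇒≃ (go f)
    where
    go : ∀ f → Pw (mono u ⊛ f) (pre u f)
    go [] = []
    go ((b , v) ∷ f) = (*-identityˡ b , ≡.refl) ∷ go f

  ⊛mono : ∀ f v → f ⊛ mono v ≃ suf v f
  ⊛mono f v = Pw⇒≃ (go f)
    where
    go : ∀ f → Pw (f ⊛ mono v) (suf v f)
    go [] = []
    go ((a , u) ∷ f) = (*-identityʳ a , ≡.refl) ∷ go f

  Words : (Word → Set) → Poly → Set c
  Words P f = All (λ t → P (proj₂ t)) f

  coeff-outside : ∀ {P} f → Words P f → ∀ w → ¬ P w → coeff f w ≈ 0#
  coeff-outside [] [] w ¬Pw = refl
  coeff-outside ((b , u) ∷ f) (Pu ∷ Pf) w ¬Pw with LP.≡-dec _≟F_ u w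
  ... | yes ≡.refl = ⊥-elim (¬Pw Pu)
  ... | no _ = trans (+-identityˡ _) (coeff-outside f Pf w ¬Pw)

  Words-· : ∀ {P} a f → Words P f → Words P (a · f)
  Words-· a [] [] = []
  Words-· a ((b , u) ∷ f) (Pu ∷ Pf) = Pu ∷ Words-· a f Pf

  Words-mapW : ∀ {P Q : Word → Set} φ → (∀ {w} → P w → Q (φ w)) → ∀ f → Words P f → Words Q (mapW φ f)
  Words-mapW φ PQ [] [] = []
  Words-mapW φ PQ ((b , u) ∷ f) (Pu ∷ Pf) = PQ Pu ∷ Words-mapW φ PQ f Pf

  -- Removing all terms with a given word; used to induct on the number
  -- of distinct words of a polynomial.
  without : Word → Poly → Poly
  without w [] = []
  without w ((b , u) ∷ f) = if u == w then without w f else (b , u) ∷ without w f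

  without-length : ∀ w f → length (without w f) ≤ length f
  without-length w [] = z≤n
  without-length w ((b , u) ∷ f) with u == w
  ... | true = ℕP.m≤n⇒m≤1+n (without-length w f)
  ... | false = s≤s (without-length w f)

  Words-without : ∀ {P} w f → Words P f → Words P (without w f)
  Words-without w [] [] = []
  Words-without w ((b , u) ∷ f) (Pu ∷ Pf) with u == w
  ... | true = Words-without w f Pf
  ... | false = Pu ∷ Words-without w f Pf

  cons≃ : ∀ b u f → (b , u) ∷ f ≃ b · mono u ⊕ f
  cons≃ b u f = ⟪ (λ z → +-congʳ (go z)) ⟫
    where
    go : ∀ z → (if u == z then b else 0#) ≈ (if u == z then b * 1# else 0#)
    go z with u == z
    ... | true = sym (*-identityʳ b)
    ... | false = refl

  split : ∀ w f → f ≃ coeff f w · mono w ⊕ without w f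
  split w [] = ⟪ (λ z → sym (trans (c+ (0# · mono w) [] (coeff-· 0# (mono w) z) refl)
                                    (trans (+-identityʳ _) (zeroˡ _)))) ⟫
  split w ((b , u) ∷ f) with LP.≡-dec _≟F_ u w
  ... | yes ≡.refl = ⟪ (λ z → trans (c≃ (cons≃ b u f) (c+ (b · mono u) f (coeff-· b (mono u) z)
                                   (c≃ (split u f) (c+ (coeff f u · mono u) (without u f) (coeff-· _ (mono u) z) refl))))
         (trans (solve 4 (λ B C M F → B :* M :+ (C :* M :+ F) := (B :+ C) :* M :+ F)
                         refl b (coeff f u) (coeff (mono u) z) (coeff (without u f) z))
                (sym (c+ ((b + coeff f u) · mono u) (without u f) (coeff-· _ (mono u) z) refl)))) ⟫
  ... | no _ = ⟪ (λ z → trans (c≃ (cons≃ b u f) (c+ (b · mono u) f (coeff-· b (mono u) z)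
                              (c≃ (split w f) (c+ (coeff f w · mono w) (without w f) (coeff-· _ (mono w) z) refl))))
         (trans (solve 5 (λ B M C N F → B :* M :+ (C :* N :+ F) := (:zero :+ C) :* N :+ (B :* M :+ F))
                         refl b (coeff (mono u) z) (coeff f w) (coeff (mono w) z) (coeff (without w f) z))
                (sym (c+ ((0# + coeff f w) · mono w) ((b , u) ∷ without w f) (coeff-· _ (mono w) z)
                        (c≃ (cons≃ b u (without w f)) (c+ (b · mono u) (without w f) (coeff-· b (mono u) z) refl)))))) ⟫

-- Reductions that record which words they act on.  Knowing the reduced
-- words is what allows a reduction of one summand to be carried out
-- inside a larger polynomial (framing).
module Reductions {c ℓ} (R : CommutativeRing c ℓ) (n : ℕ) (q : CommutativeRing.Carrier R) where
  open CommutativeRing R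
  open Alg R n q
  open Polynomials R n q

  redex : Word → Gen → Word → Word
  redex u g v = u ++ lm g ++ v

  gen[_,_,_] : Word → Gen → Word → Poly
  gen[ u , g , v ] = mono u ⊛ gen g ⊛ mono v

  gen[]≃ : ∀ u g v → gen[ u , g , v ] ≃ suf v (pre u (gen g))
  gen[]≃ u g v = ≃-trans (⊛mono (mono u ⊛ gen g) v) (suf-cong v (mono⊛ u (gen g)))

  data StepIn (P : Pred Word 0ℓ) (f h : Poly) : Set (c ⊔ ℓ) where
    step : (u v : Word) (g : Gen) → P (redex u g v) →
           h ≃ (f ⊖ coeff f (redex u g v) · gen[ u , g , v ]) → StepIn P f h

  Red : Pred Word 0ℓ → Poly → Poly → Set (c ⊔ ℓ)
  Red P f h = Σ Poly λ h′ → Star (StepIn P) f h′ × h′ ≃ h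

  Red⇒⟶* : ∀ {P f h} → Red P f h → f ⟶* h
  Red⇒⟶* {P} (h′ , steps , e) = h′ , gmap (λ x → x) forget steps , un e
    where
    forget : ∀ {f h} → StepIn P f h → Step f h
    forget (step u v g _ e) = step u v g (un e)

  red-refl : ∀ {P f h} → f ≃ h → Red P f h
  red-refl {f = f} e = f , ε , e

  red-≃ʳ : ∀ {P f h h′} → h ≃ h′ → Red P f h → Red P f h′
  red-≃ʳ e (h″ , steps , e′) = h″ , steps , ≃-trans e′ e

  -- the coefficient used by a step only depends on f up to ≃
  red-≃ˡ : ∀ {P f f′ h} → f ≃ f′ → Red P f h → Red P f′ h
  red-≃ˡ {f′ = f′} e (h′ , ε , e′) = f′ , ε , ≃-trans (≃-sym e) e′
  red-≃ˡ {f′ = f′} e (h′ , step u v g p e₁ ◅ steps , e′) =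
    h′ , step u v g p (≃-trans e₁ (⊖-cong e (·-cong (un e (redex u g v)) ≃-refl))) ◅ steps , e′

  red-trans : ∀ {P f g h} → Red P f g → Red P g h → Red P f h
  red-trans (g′ , steps₁ , e₁) r₂ with red-≃ˡ (≃-sym e₁) r₂
  ... | h′ , steps₂ , e₂ = h′ , steps₁ ◅◅ steps₂ , e₂

  red-weaken : ∀ {P Q f h} → P ⊆ Q → Red P f h → Red Q f h
  red-weaken {P} {Q} P⊆Q (h′ , steps , e) = h′ , gmap (λ x → x) weaken steps , e
    where
    weaken : ∀ {f h} → StepIn P f h → StepIn Q f h
    weaken (step u v g p e) = step u v g (P⊆Q p) e

  red-frame : ∀ {P f h} k → (∀ w → P w → coeff k w ≈ 0#) → Red P f h → Red P (f ⊕ k) (h ⊕ k)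
  red-frame {P} k k≈0 (h′ , steps , e) = h′ ⊕ k , gmap (_⊕ k) frame steps , ⊕-cong e ≃-refl
    where
    frame : ∀ {f h} → StepIn P f h → StepIn P (f ⊕ k) (h ⊕ k)
    frame {f} (step u v g p e) = step u v g p
      (≃-trans (⊕-cong e ≃-refl) (≃-trans (⊖-⊕ f _ gen[ u , g , v ] k)
        (⊖-cong ≃-refl (·-congˡ gen[ u , g , v ]
          (sym (trans (coeff-⊕ f k (redex u g v)) (trans (+-congˡ (k≈0 _ p)) (+-identityʳ _))))))))

  red-frameˡ : ∀ {P f h} k → (∀ w → P w → coeff k w ≈ 0#) → Red P f h → Red P (k ⊕ f) (k ⊕ h)
  red-frameˡ {f = f} {h} k k≈0 r = red-≃ˡ (⊕-comm f k) (red-≃ʳ (⊕-comm h k) (red-frame k k≈0 r))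

  red-scale : ∀ {P f h} a → Red P f h → Red P (a · f) (a · h)
  red-scale {P} a (h′ , steps , e) = a · h′ , gmap (a ·_) scale steps , ·-cong refl e
    where
    scale : ∀ {f h} → StepIn P f h → StepIn P (a · f) (a · h)
    scale {f} (step u v g p e) = step u v g p
      (≃-trans (·-cong refl e) (≃-trans (·-⊖ a f _ gen[ u , g , v ])
        (⊖-cong ≃-refl (·-congˡ gen[ u , g , v ] (sym (coeff-· a f (redex u g v)))))))

  StartsWith : Fin n → Pred Word 0ℓ → Pred Word 0ℓ
  StartsWith x P w = Σ Word λ w′ → w ≡ x ∷ w′ × P w′

  red-pre : ∀ {P f h} x → Red P f h → Red (StartsWith x P) (pre (x ∷ []) f) (pre (x ∷ []) h)
  red-pre {P} x (h′ , steps , e) = pre (x ∷ []) h′ , gmap (pre (x ∷ [])) prefix steps , pre-cong (x ∷ []) e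
    where
    pre-gen : ∀ u g v → pre (x ∷ []) gen[ u , g , v ] ≃ gen[ x ∷ u , g , v ]
    pre-gen u g v = ≃-trans (pre-cong (x ∷ []) (gen[]≃ u g v))
      (≃-trans (≡⇒≃ (≡.trans (mapW-∘ ((x ∷ []) ++_) (_++ v) (pre u (gen g)))
                    (≡.trans (mapW-∘ _ (u ++_) (gen g)) (≡.sym (mapW-∘ (_++ v) ((x ∷ u) ++_) (gen g))))))
               (≃-sym (gen[]≃ (x ∷ u) g v)))
    prefix : ∀ {f h} → StepIn P f h → StepIn (StartsWith x P) (pre (x ∷ []) f) (pre (x ∷ []) h)
    prefix {f} (step u v g p e) = step (x ∷ u) v g (redex u g v , ≡.refl , p)
      (≃-trans (pre-cong (x ∷ []) e)
        (≃-trans (≡⇒≃ (mapW-⊖ ((x ∷ []) ++_) f _ gen[ u , g , v ]))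
          (⊖-cong ≃-refl (·-cong (sym (coeff-pre (x ∷ []) f (redex u g v))) (pre-gen u g v)))))

  red-⊕ : ∀ {P Q f₁ h₁ f₂ h₂} → Red P f₁ h₁ → Red Q f₂ h₂ →
          (∀ w → P w → coeff f₂ w ≈ 0#) → (∀ w → Q w → coeff h₁ w ≈ 0#) →
          Red (P ∪ᵖ Q) (f₁ ⊕ f₂) (h₁ ⊕ h₂)
  red-⊕ {h₁ = h₁} {f₂ = f₂} r₁ r₂ f₂≈0 h₁≈0 =
    red-trans (red-weaken inj₁ (red-frame f₂ f₂≈0 r₁)) (red-weaken inj₂ (red-frameˡ h₁ h₁≈0 r₂))

  -- The inductive step common to all cases: given reductions of f⁺ and
  -- f⁻ whose redexes do not begin with x, reduce x f⁺ - q f⁻ and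
  -- f⁺ - x f⁻ (the shapes of t^±_{x∷xs} t_s).
  cons-step : ∀ {P : Pred Word 0ℓ} x {f⁺ h⁺ f⁻ h⁻} →
              (∀ {w} w′ → P w → w ≢ x ∷ w′) →
              Red P f⁺ h⁺ → Red P f⁻ h⁻ →
              (∀ w → P w → coeff f⁻ (x ∷ w) ≈ 0#) → (∀ w → P w → coeff h⁺ (x ∷ w) ≈ 0#) →
              Red (P ∪ᵖ StartsWith x P) (pre (x ∷ []) f⁺ ⊕ (- q) · f⁻) (pre (x ∷ []) h⁺ ⊕ (- q) · h⁻)
            × Red (P ∪ᵖ StartsWith x P) (f⁺ ⊕ (- 1#) · pre (x ∷ []) f⁻) (h⁺ ⊕ (- 1#) · pre (x ∷ []) h⁻)
  cons-step {P} x {f⁺} {h⁺} {f⁻} not-x r⁺ r⁻ f⁻≈0 h⁺≈0 =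
    red-weaken swap (red-⊕ (red-pre x r⁺) (red-scale (- q) r⁻) scaled-f⁻≈0 (pre-vanishes h⁺)) ,
    red-⊕ r⁺ (red-scale (- 1#) (red-pre x r⁻)) (λ w Pw → c0* (- 1#) (pre (x ∷ []) f⁻) (pre-vanishes f⁻ w Pw)) shifted-h⁺≈0
    where
    swap : StartsWith x P ∪ᵖ P ⊆ P ∪ᵖ StartsWith x P
    swap (inj₁ p) = inj₂ p
    swap (inj₂ p) = inj₁ p
    pre-vanishes : ∀ f w → P w → coeff (pre (x ∷ []) f) w ≈ 0#
    pre-vanishes f w Pw = coeff-pre-outside (x ∷ []) f w (λ w′ e → not-x w′ Pw (≡.sym e))
    scaled-f⁻≈0 : ∀ w → StartsWith x P w → coeff ((- q) · f⁻) w ≈ 0#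
    scaled-f⁻≈0 _ (w′ , ≡.refl , Pw′) = c0* (- q) f⁻ (f⁻≈0 w′ Pw′)
    shifted-h⁺≈0 : ∀ w → StartsWith x P w → coeff h⁺ w ≈ 0#
    shifted-h⁺≈0 _ (w′ , ≡.refl , Pw′) = h⁺≈0 w′ Pw′

module Expansions {c ℓr} (R : CommutativeRing c ℓr) (n : ℕ) (q : CommutativeRing.Carrier R) where
  open import Data.List.Membership.Propositional using (_∈_; _∉_)
  open CommutativeRing R
  open Alg R n q
  open Polynomials R n q
  open IntegerSolver R

  term⁺ term⁻ : List (Fin n) → List Bool → ℕ → Poly
  term⁺ js bs k = if odd k then []
                  else (((- 1#) ^ ℓ bs) * ((- q) ^ ⌊ k /2⌋)) · tL (unselected bs js)
  term⁻ js bs k = if odd k then (((- 1#) ^ ℓ bs) * ((- q) ^ ⌊ k ∸ℕ 1 /2⌋)) · tL (unselected bs js)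
                  else []

  T⁺ T⁻ : List (Fin n) → Poly
  T⁺ js = Σsel (selections (length js)) (λ bs → term⁺ js bs (countTrue bs))
  T⁻ js = Σsel (selections (length js)) (λ bs → term⁻ js bs (countTrue bs))

  private
    ℓsum-shift : ∀ ν k bs → ℓsum (suc ν) (positions (suc k) bs) ≡ ℓsum ν (positions k bs)
    ℓsum-shift ν k [] = ≡.refl
    ℓsum-shift ν k (true ∷ bs) = ≡.cong ((k ∸ℕ ν) +ℕ_) (ℓsum-shift (suc ν) (suc k) bs)
    ℓsum-shift ν k (false ∷ bs) = ℓsum-shift ν (suc k) bs

    ℓsum-up : ∀ ν k bs → ν ≤ k → ℓsum ν (positions (suc k) bs) ≡ countTrue bs +ℕ ℓsum ν (positions k bs)
    ℓsum-up ν k [] ν≤k = ≡.refl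
    ℓsum-up ν k (true ∷ bs) ν≤k =
      ≡.trans (≡.cong₂ _+ℕ_ (ℕP.+-∸-assoc 1 ν≤k) (ℓsum-up (suc ν) (suc k) bs (s≤s ν≤k)))
              (≡.cong suc (ℕ-x+[y+z]≡y+[x+z] (k ∸ℕ ν) (countTrue bs) _))
    ℓsum-up ν k (false ∷ bs) ν≤k = ℓsum-up ν (suc k) bs (ℕP.m≤n⇒m≤1+n ν≤k)

  ℓ-true : ∀ bs → ℓ (true ∷ bs) ≡ ℓ bs
  ℓ-true = ℓsum-shift 1 1

  ℓ-false : ∀ bs → ℓ (false ∷ bs) ≡ countTrue bs +ℕ ℓ bs
  ℓ-false bs = ℓsum-up 1 1 bs (s≤s z≤n)

  ^-+ : ∀ a m k → a ^ (m +ℕ k) ≈ a ^ m * a ^ k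
  ^-+ a zero k = sym (*-identityˡ _)
  ^-+ a (suc m) k = trans (*-congˡ (^-+ a m k)) (sym (*-assoc _ _ _))

  sign : Bool → Carrier
  sign b = if b then - 1# else 1#

  -1^-parity : ∀ k → (- 1#) ^ k ≈ sign (odd k)
  -1^-parity zero = refl
  -1^-parity (suc k) with odd k | -1^-parity k
  ... | true | e = trans (*-congˡ e) (solve 0 (:-one :* :-one := :one) refl)
  ... | false | e = trans (*-congˡ e) (*-identityʳ _)

  -- moving a letter not in I past the elements of I changes the sign by (-1)^#I
  -1^ℓ-false : ∀ bs → (- 1#) ^ ℓ (false ∷ bs) ≈ sign (odd (countTrue bs)) * (- 1#) ^ ℓ bs
  -1^ℓ-false bs = trans (reflexive (≡.cong ((- 1#) ^_) (ℓ-false bs)))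
                  (trans (^-+ (- 1#) (countTrue bs) (ℓ bs)) (*-congʳ (-1^-parity (countTrue bs))))

  term⁺-true : ∀ x xs bs k → term⁺ (x ∷ xs) (true ∷ bs) (suc k) ≃ (- q) · term⁻ xs bs k
  term⁺-true x xs bs zero = ≃-refl
  term⁺-true x xs bs (suc k) with odd k
  ... | true = ≃-refl
  ... | false = ≃-trans (·-congˡ (tL (unselected bs xs)) e) (≃-sym (·-assoc (- q) _ (tL (unselected bs xs))))
    where
    e : ((- 1#) ^ ℓ (true ∷ bs)) * ((- q) * ((- q) ^ ⌊ k /2⌋)) ≈ (- q) * (((- 1#) ^ ℓ bs) * ((- q) ^ ⌊ k /2⌋))
    e = trans (*-congʳ (reflexive (≡.cong ((- 1#) ^_) (ℓ-true bs))))
              (solve 3 (λ A B C → A :* (B :* C) := B :* (A :* C)) refl _ _ _)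

  term⁻-true : ∀ x xs bs k → term⁻ (x ∷ xs) (true ∷ bs) (suc k) ≃ term⁺ xs bs k
  term⁻-true x xs bs k with odd k
  ... | true = ≃-refl
  ... | false = ·-congˡ (tL (unselected bs xs)) (*-congʳ (reflexive (≡.cong ((- 1#) ^_) (ℓ-true bs))))

  term⁺-false : ∀ x xs bs → term⁺ (x ∷ xs) (false ∷ bs) (countTrue bs) ≃ pre (x ∷ []) (term⁺ xs bs (countTrue bs))
  term⁺-false x xs bs with odd (countTrue bs) | -1^ℓ-false bs
  ... | true | _ = ≃-refl
  ... | false | e = ≃-trans (·-congˡ (mono (x ∷ unselected bs xs)) (*-congʳ (trans e (*-identityˡ _))))
                      (≡⇒≃ (≡.sym (mapW-· ((x ∷ []) ++_) _ (mono (unselected bs xs)))))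

  term⁻-false : ∀ x xs bs → term⁻ (x ∷ xs) (false ∷ bs) (countTrue bs) ≃ (- 1#) · pre (x ∷ []) (term⁻ xs bs (countTrue bs))
  term⁻-false x xs bs with odd (countTrue bs) | -1^ℓ-false bs
  ... | false | _ = ≃-refl
  ... | true | e = ≃-trans (·-congˡ (mono (x ∷ unselected bs xs)) (trans (*-congʳ e) (*-assoc _ _ _)))
                     (≃-trans (≃-sym (·-assoc (- 1#) _ (mono (x ∷ unselected bs xs))))
                       (≡⇒≃ (≡.cong ((- 1#) ·_) (≡.sym (mapW-· ((x ∷ []) ++_) _ (mono (unselected bs xs)))))))

  Σsel-cong : ∀ {F H : List Bool → Poly} L → (∀ bs → F bs ≃ H bs) → Σsel L F ≃ Σsel L H
  Σsel-cong [] e = ≃-refl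
  Σsel-cong (bs ∷ L) e = ⊕-cong (e bs) (Σsel-cong L e)

  Σsel-⊕ : ∀ (F H : List Bool → Poly) L → Σsel L (λ bs → F bs ⊕ H bs) ≃ Σsel L F ⊕ Σsel L H
  Σsel-⊕ F H [] = ≃-refl
  Σsel-⊕ F H (bs ∷ L) = ⟪ (λ w → trans (c+ (F bs ⊕ H bs) _ (coeff-⊕ (F bs) (H bs) w) (un (Σsel-⊕ F H L) w))
    (trans (trans (+-congˡ (coeff-⊕ (Σsel L F) (Σsel L H) w))
                  (solve 4 (λ A B C D → (A :+ B) :+ (C :+ D) := (A :+ C) :+ (B :+ D)) refl _ _ _ _))
           (sym (c+ (F bs ⊕ Σsel L F) _ (coeff-⊕ (F bs) (Σsel L F) w) (coeff-⊕ (H bs) (Σsel L H) w))))) ⟫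

  Σsel-map : ∀ (φ : Carrier × Word → Carrier × Word) (F : List Bool → Poly) L →
             Σsel L (λ bs → map φ (F bs)) ≡ map φ (Σsel L F)
  Σsel-map φ F L = ≡.sym (LP.map-concatMap φ F L)

  branch : List Bool → List (List Bool)
  branch bs = (true ∷ bs) ∷ (false ∷ bs) ∷ []

  Σsel-split : ∀ (F : List Bool → Poly) L →
               Σsel (concatMap branch L) F ≃ Σsel L (λ bs → F (true ∷ bs) ⊕ F (false ∷ bs))
  Σsel-split F [] = ≃-refl
  Σsel-split F (bs ∷ L) = ≃-trans
    (≡⇒≃ (≡.trans (LP.concatMap-++ F (branch bs) (concatMap branch L))
           (≡.trans (⊕-assoc (F (true ∷ bs)) (F (false ∷ bs) ++ []) _)
           (≡.trans (≡.cong (λ z → F (true ∷ bs) ⊕ (z ⊕ Σsel (concatMap branch L) F)) (LP.++-identityʳ (F (false ∷ bs))))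
                    (≡.sym (⊕-assoc (F (true ∷ bs)) (F (false ∷ bs)) _))))))
    (⊕-cong (≃-refl {F (true ∷ bs) ⊕ F (false ∷ bs)}) (Σsel-split F L))

  T⁺-cons : ∀ x xs → T⁺ (x ∷ xs) ≃ pre (x ∷ []) (T⁺ xs) ⊕ (- q) · T⁻ xs
  T⁺-cons x xs = ≃-trans (Σsel-split (λ bs → term⁺ (x ∷ xs) bs (countTrue bs)) S)
    (≃-trans (Σsel-cong S (λ bs → ⊕-cong (term⁺-true x xs bs (countTrue bs)) (term⁺-false x xs bs)))
    (≃-trans (Σsel-⊕ (λ bs → (- q) · term⁻ xs bs (countTrue bs)) (λ bs → pre (x ∷ []) (term⁺ xs bs (countTrue bs))) S)
    (≃-trans (≡⇒≃ (≡.cong₂ _⊕_ (Σsel-map _ (λ bs → term⁻ xs bs (countTrue bs)) S)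
                               (Σsel-map _ (λ bs → term⁺ xs bs (countTrue bs)) S)))
             (⊕-comm ((- q) · T⁻ xs) (pre (x ∷ []) (T⁺ xs))))))
    where S = selections (length xs)

  T⁻-cons : ∀ x xs → T⁻ (x ∷ xs) ≃ T⁺ xs ⊕ (- 1#) · pre (x ∷ []) (T⁻ xs)
  T⁻-cons x xs = ≃-trans (Σsel-split (λ bs → term⁻ (x ∷ xs) bs (countTrue bs)) S)
    (≃-trans (Σsel-cong S (λ bs → ⊕-cong (term⁻-true x xs bs (countTrue bs)) (term⁻-false x xs bs)))
    (≃-trans (Σsel-⊕ (λ bs → term⁺ xs bs (countTrue bs)) (λ bs → (- 1#) · pre (x ∷ []) (term⁻ xs bs (countTrue bs))) S)
             (⊕-cong (≃-refl {T⁺ xs}) (≡⇒≃ (≡.trans (Σsel-map _ (λ bs → pre (x ∷ []) (term⁻ xs bs (countTrue bs))) S)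
                                                  (≡.cong ((- 1#) ·_) (Σsel-map _ (λ bs → term⁻ xs bs (countTrue bs)) S)))))))
    where S = selections (length xs)

  coeff-T⁺-cons : ∀ x xs z → coeff (T⁺ (x ∷ xs)) z ≈ coeff (pre (x ∷ []) (T⁺ xs)) z + (- q) * coeff (T⁻ xs) z
  coeff-T⁺-cons x xs z = c≃ (T⁺-cons x xs) (c+ (pre (x ∷ []) (T⁺ xs)) ((- q) · T⁻ xs) refl (coeff-· (- q) (T⁻ xs) z))

  coeff-T⁻-cons : ∀ x xs z → coeff (T⁻ (x ∷ xs)) z ≈ coeff (T⁺ xs) z + (- 1#) * coeff (pre (x ∷ []) (T⁻ xs)) z
  coeff-T⁻-cons x xs z = c≃ (T⁻-cons x xs) (c+ (T⁺ xs) ((- 1#) · pre (x ∷ []) (T⁻ xs)) refl (coeff-· (- 1#) (pre (x ∷ []) (T⁻ xs)) z))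

  coeff-pre-T⁺-cons : ∀ y x xs z → coeff (pre (y ∷ []) (T⁺ (x ∷ xs))) z
                      ≈ coeff (pre (y ∷ x ∷ []) (T⁺ xs)) z + (- q) * coeff (pre (y ∷ []) (T⁻ xs)) z
  coeff-pre-T⁺-cons y x xs z = c≃ (pre-cong (y ∷ []) (T⁺-cons x xs))
    (c≃ (≡⇒≃ (mapW-⊕ ((y ∷ []) ++_) (pre (x ∷ []) (T⁺ xs)) _))
        (c+ (pre (y ∷ []) (pre (x ∷ []) (T⁺ xs))) (pre (y ∷ []) ((- q) · T⁻ xs))
            (reflexive (≡.cong (λ f → coeff f z) (pre-pre y (x ∷ []) (T⁺ xs))))
            (c≃ (≡⇒≃ (mapW-· ((y ∷ []) ++_) (- q) (T⁻ xs))) (coeff-· (- q) (pre (y ∷ []) (T⁻ xs)) z))))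

  coeff-pre-T⁻-cons : ∀ y x xs z → coeff (pre (y ∷ []) (T⁻ (x ∷ xs))) z
                      ≈ coeff (pre (y ∷ []) (T⁺ xs)) z + (- 1#) * coeff (pre (y ∷ x ∷ []) (T⁻ xs)) z
  coeff-pre-T⁻-cons y x xs z = c≃ (pre-cong (y ∷ []) (T⁻-cons x xs))
    (c≃ (≡⇒≃ (mapW-⊕ ((y ∷ []) ++_) (T⁺ xs) _))
        (c+ (pre (y ∷ []) (T⁺ xs)) (pre (y ∷ []) ((- 1#) · pre (x ∷ []) (T⁻ xs))) refl
            (c≃ (≡⇒≃ (mapW-· ((y ∷ []) ++_) (- 1#) (pre (x ∷ []) (T⁻ xs))))
                (c* (- 1#) (pre (y ∷ []) (pre (x ∷ []) (T⁻ xs))) (reflexive (≡.cong (λ f → coeff f z) (pre-pre y (x ∷ []) (T⁻ xs))))))))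

  Letters : List (Fin n) → Word → Set
  Letters js = All (_∈ js)

  unselected-All : ∀ {Q : Fin n → Set} bs js → All Q js → All Q (unselected bs js)
  unselected-All (false ∷ bs) (x ∷ js) (Qx ∷ Qjs) = Qx ∷ unselected-All bs js Qjs
  unselected-All (true ∷ bs) (x ∷ js) (Qx ∷ Qjs) = unselected-All bs js Qjs
  unselected-All [] js Qjs = []
  unselected-All (true ∷ bs) [] Qjs = []
  unselected-All (false ∷ bs) [] Qjs = []

  Words-Σsel : ∀ {P} (F : List Bool → Poly) → (∀ bs → Words P (F bs)) → ∀ L → Words P (Σsel L F)
  Words-Σsel F PF [] = []
  Words-Σsel F PF (bs ∷ L) = AllP.++⁺ (PF bs) (Words-Σsel F PF L)

  Words-tL : ∀ a js bs → Words (Letters js) (a · tL (unselected bs js))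
  Words-tL a js bs = unselected-All bs js (All.tabulate (λ x∈js → x∈js)) ∷ []

  Words-T⁺ : ∀ js → Words (Letters js) (T⁺ js)
  Words-T⁺ js = Words-Σsel _ term (selections (length js))
    where
    term : ∀ bs → Words (Letters js) (term⁺ js bs (countTrue bs))
    term bs with odd (countTrue bs)
    ... | true = []
    ... | false = Words-tL _ js bs

  Words-T⁻ : ∀ js → Words (Letters js) (T⁻ js)
  Words-T⁻ js = Words-Σsel _ term (selections (length js))
    where
    term : ∀ bs → Words (Letters js) (term⁻ js bs (countTrue bs))
    term bs with odd (countTrue bs)
    ... | true = Words-tL _ js bs
    ... | false = []

-- The layer lemma: if every word of f lies in Q, then (L·f + k), with L the
-- leading word of a generator, reduces to ρ(f) + k, where ρ(w) = L w - g w
-- is the linear map rewriting the leading word.  One step is spent on each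
-- distinct word of f; this is how a whole polynomial is pushed through a
-- single rewriting rule t_r t_r → q or t_r t_p → -t_p t_r + 2q.
module Layers {c ℓ} (R : CommutativeRing c ℓ) (n : ℕ) (q : CommutativeRing.Carrier R) where
  open CommutativeRing R
  open Alg R n q
  open Polynomials R n q
  open Reductions R n q
  open IntegerSolver R

  record Linear (ρ : Poly → Poly) : Set (c ⊔ ℓ) where
    field
      ρ-cong : ∀ {f f′} → f ≃ f′ → ρ f ≃ ρ f′
      ρ-⊕ : ∀ f f′ → ρ (f ⊕ f′) ≃ ρ f ⊕ ρ f′
      ρ-· : ∀ a f → ρ (a · f) ≃ a · ρ f

  module Layer (g : Gen) (ρ : Poly → Poly) (ρ-linear : Linear ρ) (Q : Pred Word 0ℓ)
               (rewrite-lm : ∀ w → gen[ [] , g , w ] ≃ pre (lm g) (mono w) ⊖ ρ (mono w))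
               (no-new-redex : ∀ w₁ w₂ → Q w₁ → Q w₂ → coeff (ρ (mono w₁)) (lm g ++ w₂) ≈ 0#) where
    open Linear ρ-linear

    L : Word
    L = lm g

    InLayer : Pred Word 0ℓ
    InLayer W = Σ Word λ w → W ≡ L ++ w × Q w

    ρ-[] : ρ [] ≃ []
    ρ-[] = ≃-trans (ρ-· 0# []) ⟪ (λ w → trans (coeff-· 0# (ρ []) w) (zeroˡ _)) ⟫

    layer-step : ∀ w f k → Q w → coeff k (L ++ w) ≈ 0# →
                 Red InLayer (pre L f ⊕ k) (pre L (without w f) ⊕ (coeff f w · ρ (mono w) ⊕ k))
    layer-step w f k Qw k≈0 = _ , step [] w g (w , ≡.refl , Qw) result ◅ ε , ≃-refl
      where
      a = coeff f w
      Lw = pre L (mono w)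
      F = pre L f ⊕ k
      coeff-F : coeff F (L ++ w) ≈ a
      coeff-F = trans (c+ (pre L f) k (coeff-pre L f w) k≈0) (+-identityʳ _)
      pre-split : pre L f ≃ a · Lw ⊕ pre L (without w f)
      pre-split = ≃-trans (pre-cong L (split w f)) (≡⇒≃ (≡.trans (mapW-⊕ (L ++_) (a · mono w) _)
                                                        (≡.cong (_⊕ pre L (without w f)) (mapW-· (L ++_) a (mono w)))))
      result : pre L (without w f) ⊕ (a · ρ (mono w) ⊕ k) ≃ F ⊖ coeff F (L ++ w) · gen[ [] , g , w ]
      result = ⟪ (λ z → trans (c+ (pre L (without w f)) (a · ρ (mono w) ⊕ k) refl (c+ (a · ρ (mono w)) k (coeff-· a (ρ (mono w)) z) refl))
        (trans (solve 5 (λ A M W ρw K → W :+ (A :* ρw :+ K)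
                                      := (A :* M :+ W) :+ K :+ :-one :* (A :* (M :+ :-one :* ρw)))
                        refl a (coeff Lw z) (coeff (pre L (without w f)) z) (coeff (ρ (mono w)) z) (coeff k z))
               (sym (c- F (coeff F (L ++ w) · gen[ [] , g , w ])
                        (c+ (pre L f) k (c≃ pre-split (c+ (a · Lw) (pre L (without w f)) (coeff-· a Lw z) refl)) refl)
                        (trans (c* _ gen[ [] , g , w ] (c≃ (rewrite-lm w) (c- Lw (ρ (mono w)) refl refl)))
                               (*-congʳ coeff-F)))))) ⟫

    without-head : ∀ a w f → without w ((a , w) ∷ f) ≡ without w f
    without-head a w f rewrite ==-refl w = ≡.refl

    ρ-split : ∀ w f → ρ f ≃ coeff f w · ρ (mono w) ⊕ ρ (without w f)
    ρ-split w f = ≃-trans (ρ-cong (split w f))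
                    (≃-trans (ρ-⊕ _ (without w f)) (⊕-cong (ρ-· (coeff f w) (mono w)) ≃-refl))

    layer-bounded : ∀ m f → length f ≤ m → Words Q f → ∀ k → (∀ w → Q w → coeff k (L ++ w) ≈ 0#) →
                    Red InLayer (pre L f ⊕ k) (ρ f ⊕ k)
    layer-bounded m [] _ _ k _ = red-refl (⊕-cong (≃-sym ρ-[]) (≃-refl {k}))
    layer-bounded (suc m) f₀@((a , w) ∷ f) (s≤s len) (Qw ∷ Qf) k k≈0 =
      red-trans (layer-step w f₀ k Qw (k≈0 w Qw))
        (red-≃ˡ (≡⇒≃ (≡.cong (λ h → pre L h ⊕ k′) (≡.sym (without-head a w f))))
          (red-≃ʳ done
            (layer-bounded m (without w f) (ℕP.≤-trans (without-length w f) len) (Words-without w f Qf) k′ k′≈0)))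
      where
      c′ = coeff f₀ w
      k′ = c′ · ρ (mono w) ⊕ k
      k′≈0 : ∀ w₂ → Q w₂ → coeff k′ (L ++ w₂) ≈ 0#
      k′≈0 w₂ Qw₂ = c0+ (c′ · ρ (mono w)) k (c0* c′ (ρ (mono w)) (no-new-redex w w₂ Qw Qw₂)) (k≈0 w₂ Qw₂)
      done : ρ (without w f) ⊕ k′ ≃ ρ f₀ ⊕ k
      done = ≃-trans (≡⇒≃ (≡.sym (⊕-assoc (ρ (without w f)) (c′ · ρ (mono w)) k)))
               (⊕-cong (≃-trans (⊕-comm (ρ (without w f)) _)
                                (≃-sym (≃-trans (ρ-split w f₀) (⊕-cong ≃-refl (≡⇒≃ (≡.cong ρ (without-head a w f)))))))
                       (≃-refl {k}))

    layer : ∀ f → Words Q f → ∀ k → (∀ w → Q w → coeff k (L ++ w) ≈ 0#) → Red InLayer (pre L f ⊕ k) (ρ f ⊕ k)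
    layer f = layer-bounded (length f) f ℕP.≤-refl

  ρ-square : Poly → Poly
  ρ-square f = q · f

  ρ-square-linear : Linear ρ-square
  ρ-square-linear = record
    { ρ-cong = ·-cong refl ; ρ-⊕ = λ f f′ → ≡⇒≃ (·-⊕ q f f′) ; ρ-· = λ a f → ·-comm q a f }

  square-rewrite : ∀ r w → gen[ [] , sq r , w ] ≃ pre (r ∷ r ∷ []) (mono w) ⊖ ρ-square (mono w)
  square-rewrite r w = gen[]≃ [] (sq r) w

  two : Carrier
  two = 1# + 1#

  ρ-swap : Fin n → Fin n → Poly → Poly
  ρ-swap p r f = (- 1#) · pre (p ∷ r ∷ []) f ⊕ (two * q) · f

  ρ-swap-linear : ∀ p r → Linear (ρ-swap p r)
  ρ-swap-linear p r = record { ρ-cong = cong ; ρ-⊕ = additive ; ρ-· = homogeneous }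
    where
    pr = p ∷ r ∷ []
    cong : ∀ {f f′} → f ≃ f′ → ρ-swap p r f ≃ ρ-swap p r f′
    cong e = ⊕-cong (·-cong refl (pre-cong pr e)) (·-cong refl e)
    additive : ∀ f f′ → ρ-swap p r (f ⊕ f′) ≃ ρ-swap p r f ⊕ ρ-swap p r f′
    additive f f′ = ⟪ (λ z → trans (c+ ((- 1#) · pre pr (f ⊕ f′)) _
                                 (c* (- 1#) (pre pr (f ⊕ f′)) (c≃ (≡⇒≃ (mapW-⊕ (pr ++_) f f′)) (c+ (pre pr f) (pre pr f′) refl refl)))
                                 (c* (two * q) (f ⊕ f′) (c+ f f′ refl refl)))
      (trans (solve 5 (λ T A B C D → :-one :* (A :+ B) :+ T :* (C :+ D)
                                  := (:-one :* A :+ T :* C) :+ (:-one :* B :+ T :* D))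
                      refl (two * q) (coeff (pre pr f) z) (coeff (pre pr f′) z) (coeff f z) (coeff f′ z))
             (sym (c+ (ρ-swap p r f) (ρ-swap p r f′) (coeff-lin (- 1#) (pre pr f) (two * q) f z)
                                                    (coeff-lin (- 1#) (pre pr f′) (two * q) f′ z))))) ⟫
    homogeneous : ∀ a f → ρ-swap p r (a · f) ≃ a · ρ-swap p r f
    homogeneous a f = ≃-trans (⊕-cong (≃-trans (≡⇒≃ (≡.cong ((- 1#) ·_) (mapW-· (pr ++_) a f))) (·-comm (- 1#) a _))
                                      (·-comm _ a f))
                              (≡⇒≃ (≡.sym (·-⊕ a ((- 1#) · pre pr f) ((two * q) · f))))

  swap-rewrite : ∀ p r (p<r : p < r) w → gen[ [] , anti p r p<r , w ] ≃ pre (r ∷ p ∷ []) (mono w) ⊖ ρ-swap p r (mono w)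
  swap-rewrite p r p<r w = ≃-trans (gen[]≃ [] (anti p r p<r) w)
    (Pw⇒≃ ((refl , ≡.refl) ∷ (solve 0 (:one := :-one :* (:-one :* :one)) refl , ≡.refl)
           ∷ (refl , ≡.refl) ∷ []))

module SortedLists where
  open import Data.Fin.Subset using (Subset; ⁅_⁆; ∣_∣) renaming (_∈_ to _∈ˢ_; _∉_ to _∉ˢ_; _∪_ to _∪ˢ_)
  import Data.Fin.Subset.Properties as SubsetP
  open import Data.Vec using ([]; _∷_; here; there)
  open import Data.List.Membership.Propositional using (_∈_; _∉_)
  open import Data.List.Membership.Propositional.Properties using (∈-map⁺; ∈-map⁻)
  Sorted : ∀ {n} → List (Fin n) → Set
  Sorted = AllPairs _<_

  ∉-above : ∀ {n} {x : Fin n} {xs} → All (x <_) xs → x ∉ xs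
  ∉-above x<xs x∈xs = FinP.<-irrefl ≡.refl (All.lookup x<xs x∈xs)

  insert : ∀ {n} → Fin n → List (Fin n) → List (Fin n)
  insert s [] = s ∷ []
  insert s (x ∷ xs) with s <? x
  ... | yes _ = s ∷ x ∷ xs
  ... | no _ = x ∷ insert s xs

  above : ∀ {n} → Fin n → List (Fin n) → ℕ
  above s js = length (filter (s <?_) js)

  insert-below : ∀ {n} {s x : Fin n} xs → s < x → insert s (x ∷ xs) ≡ s ∷ x ∷ xs
  insert-below {s = s} {x} xs s<x with s <? x
  ... | yes _ = ≡.refl
  ... | no s≮x = ⊥-elim (s≮x s<x)

  insert-skip : ∀ {n} {s x : Fin n} xs → ¬ s < x → insert s (x ∷ xs) ≡ x ∷ insert s xs
  insert-skip {s = s} {x} xs s≮x with s <? x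
  ... | yes s<x = ⊥-elim (s≮x s<x)
  ... | no _ = ≡.refl

  ∉-insert : ∀ {n} {a s : Fin n} xs → a ∉ xs → a ≢ s → a ∉ insert s xs
  ∉-insert [] a∉ a≢s (here a≡s) = a≢s a≡s
  ∉-insert {s = s} (x ∷ xs) a∉ a≢s a∈ with s <? x | a∈
  ... | yes _ | here a≡s = a≢s a≡s
  ... | yes _ | there a∈xxs = a∉ a∈xxs
  ... | no _ | here a≡x = a∉ (here a≡x)
  ... | no _ | there a∈ins = ∉-insert xs (λ a∈xs → a∉ (there a∈xs)) a≢s a∈ins

  above-below : ∀ {n} {s x : Fin n} xs → s < x → above s (x ∷ xs) ≡ suc (above s xs)
  above-below xs s<x = ≡.cong length (LP.filter-accept (_ <?_) s<x)

  above-skip : ∀ {n} {s x : Fin n} xs → x < s → above s (x ∷ xs) ≡ above s xs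
  above-skip xs x<s = ≡.cong length (LP.filter-reject (_ <?_) (λ s<x → FinP.<-asym s<x x<s))

  above-all : ∀ {n} {s : Fin n} xs → All (s <_) xs → above s xs ≡ length xs
  above-all [] [] = ≡.refl
  above-all (x ∷ xs) (s<x ∷ s<xs) = ≡.trans (above-below xs s<x) (≡.cong suc (above-all xs s<xs))

  private
    map-suc-sorted : ∀ {n} {xs : List (Fin n)} → Sorted xs → Sorted (map (suc {n}) xs)
    map-suc-sorted [] = []
    map-suc-sorted (x<xs ∷ sorted) = shift x<xs ∷ map-suc-sorted sorted
      where
      shift : ∀ {n} {x : Fin n} {ys} → All (x <_) ys → All (suc x <_) (map (suc {n}) ys)
      shift [] = []
      shift (x<y ∷ x<ys) = ℕ.s<s x<y ∷ shift x<ys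

    zero-below : ∀ {n} (xs : List (Fin n)) → All (zero {n} <_) (map suc xs)
    zero-below [] = []
    zero-below (x ∷ xs) = ℕ.z<s ∷ zero-below xs

    insert-suc : ∀ {n} (s : Fin n) xs → insert (suc s) (map suc xs) ≡ map suc (insert s xs)
    insert-suc s [] = ≡.refl
    insert-suc s (x ∷ xs) with s <? x
    ... | yes s<x = insert-below (map suc xs) (ℕ.s<s s<x)
    ... | no s≮x = ≡.trans (insert-skip (map suc xs) (λ s<x → s≮x (ℕ.s<s⁻¹ s<x))) (≡.cong (suc x ∷_) (insert-suc s xs))

    insert-zero : ∀ {n} (xs : List (Fin n)) → insert zero (map suc xs) ≡ zero ∷ map suc xs
    insert-zero [] = ≡.refl
    insert-zero (x ∷ xs) = insert-below (map suc xs) ℕ.z<s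

  elems-sorted : ∀ {n} (J : Subset n) → Sorted (elems J)
  elems-sorted [] = []
  elems-sorted (true ∷ J) = zero-below (elems J) ∷ map-suc-sorted (elems-sorted J)
  elems-sorted (false ∷ J) = map-suc-sorted (elems-sorted J)

  elems-∈ : ∀ {n} {s : Fin n} {J : Subset n} → s ∈ˢ J → s ∈ elems J
  elems-∈ here = here ≡.refl
  elems-∈ {J = true ∷ J} (there s∈J) = there (∈-map⁺ suc (elems-∈ s∈J))
  elems-∈ {J = false ∷ J} (there s∈J) = ∈-map⁺ suc (elems-∈ s∈J)

  elems-∈⁻ : ∀ {n} {s : Fin n} (J : Subset n) → s ∈ elems J → s ∈ˢ J
  elems-∈⁻ (true ∷ J) (here ≡.refl) = here
  elems-∈⁻ (true ∷ J) (there s∈) with ∈-map⁻ suc s∈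
  ... | _ , s∈J , ≡.refl = there (elems-∈⁻ J s∈J)
  elems-∈⁻ (false ∷ J) s∈ with ∈-map⁻ suc s∈
  ... | _ , s∈J , ≡.refl = there (elems-∈⁻ J s∈J)

  ∣∣≡length : ∀ {n} (J : Subset n) → ∣ J ∣ ≡ length (elems J)
  ∣∣≡length [] = ≡.refl
  ∣∣≡length (true ∷ J) = ≡.cong suc (≡.trans (∣∣≡length J) (≡.sym (LP.length-map suc (elems J))))
  ∣∣≡length (false ∷ J) = ≡.trans (∣∣≡length J) (≡.sym (LP.length-map suc (elems J)))

  elems-∪ : ∀ {n} (s : Fin n) (J : Subset n) → s ∉ˢ J → elems (J ∪ˢ ⁅ s ⁆) ≡ insert s (elems J)
  elems-∪ zero (true ∷ J) s∉J = ⊥-elim (s∉J here)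
  elems-∪ zero (false ∷ J) s∉J =
    ≡.trans (≡.cong (λ K → zero ∷ map suc (elems K)) (SubsetP.∪-identityʳ J)) (≡.sym (insert-zero (elems J)))
  elems-∪ (suc s) (true ∷ J) s∉J =
    ≡.trans (≡.cong (λ K → zero ∷ map suc K) (elems-∪ s J (λ s∈J → s∉J (there s∈J))))
            (≡.trans (≡.cong (zero ∷_) (≡.sym (insert-suc s (elems J)))) (≡.sym (insert-skip (map suc (elems J)) (λ ()))))
  elems-∪ (suc s) (false ∷ J) s∉J =
    ≡.trans (≡.cong (map suc) (elems-∪ s J (λ s∈J → s∉J (there s∈J)))) (≡.sym (insert-suc s (elems J)))

  insert-least : ∀ {n} {s : Fin n} xs → All (s <_) xs → insert s xs ≡ s ∷ xs
  insert-least [] [] = ≡.refl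
  insert-least (x ∷ xs) (s<x ∷ _) = insert-below xs s<x

open SortedLists

module Moves {c ℓ} (R : CommutativeRing c ℓ) (n : ℕ) (q : CommutativeRing.Carrier R) (s : Fin n) where
  open import Data.List.Membership.Propositional using (_∈_; _∉_)
  open CommutativeRing R
  open Alg R n q
  open Polynomials R n q
  open Reductions R n q
  open Expansions R n q
  open Layers R n q
  open IntegerSolver R
  open import Relation.Binary.Reasoning.Setoid setoid

  infixl 8 _·tₛ
  _·tₛ : Poly → Poly
  f ·tₛ = suf (s ∷ []) f

  pre-·tₛ : ∀ x f → pre (x ∷ []) f ·tₛ ≡ pre (x ∷ []) (f ·tₛ)
  pre-·tₛ x = suf-pre (s ∷ []) x

  T⁺-cons-·tₛ : ∀ x xs → T⁺ (x ∷ xs) ·tₛ ≃ pre (x ∷ []) (T⁺ xs ·tₛ) ⊕ (- q) · T⁻ xs ·tₛ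
  T⁺-cons-·tₛ x xs = ≃-trans (suf-cong (s ∷ []) (T⁺-cons x xs))
    (≡⇒≃ (≡.trans (mapW-⊕ (_++ (s ∷ [])) (pre (x ∷ []) (T⁺ xs)) _)
                  (≡.cong₂ _⊕_ (pre-·tₛ x (T⁺ xs)) (mapW-· (_++ (s ∷ [])) (- q) (T⁻ xs)))))

  T⁻-cons-·tₛ : ∀ x xs → T⁻ (x ∷ xs) ·tₛ ≃ T⁺ xs ·tₛ ⊕ (- 1#) · pre (x ∷ []) (T⁻ xs ·tₛ)
  T⁻-cons-·tₛ x xs = ≃-trans (suf-cong (s ∷ []) (T⁻-cons x xs))
    (≡⇒≃ (≡.trans (mapW-⊕ (_++ (s ∷ [])) (T⁺ xs) _)
                  (≡.cong (T⁺ xs ·tₛ ⊕_) (≡.trans (mapW-· (_++ (s ∷ [])) (- 1#) _)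
                                                   (≡.cong ((- 1#) ·_) (pre-·tₛ x (T⁻ xs)))))))

  EndsWithₛ : List (Fin n) → Pred Word 0ℓ
  EndsWithₛ xs w = Σ Word λ W → w ≡ W ++ (s ∷ []) × Letters xs W

  ·tₛ-head : ∀ xs f → Words (Letters xs) f → ∀ {x} w → x ∉ xs → (x ≢ s ⊎ w ≢ []) → coeff (f ·tₛ) (x ∷ w) ≈ 0#
  ·tₛ-head xs f Lf {x} w x∉xs side =
    coeff-outside (f ·tₛ) (Words-mapW {Letters xs} {EndsWithₛ xs} (_++ (s ∷ [])) (λ {W} LW → W , ≡.refl , LW) f Lf) (x ∷ w) excluded
    where
    excluded : ¬ EndsWithₛ xs (x ∷ w)
    excluded ([] , e , _) = [ (λ x≢s → x≢s (LP.∷-injectiveˡ e)) , (λ w≢[] → w≢[] (LP.∷-injectiveʳ e)) ] side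
    excluded (y ∷ W , e , y∈xs ∷ _) rewrite LP.∷-injectiveˡ e = x∉xs y∈xs

  -- Redexes met while t_s travels left through letters larger than s:
  -- they begin with a letter of xs and still contain s.
  Passing : List (Fin n) → Pred Word 0ℓ
  Passing xs w = Σ (Fin n) λ y → Σ Word λ w′ → w ≡ y ∷ w′ × y ∈ xs × Letters (s ∷ xs) w′ × s ∈ w′

  -- the result of moving t_s to the front of t^±_{xs}, when s < xs
  δ : List (Fin n) → Carrier
  δ xs = (two * (- 1#) ^ suc (length xs)) * q

  passed⁺ passed⁻ : List (Fin n) → Poly
  passed⁺ xs = (- 1#) ^ length xs · pre (s ∷ []) (T⁺ xs) ⊕ δ xs · T⁻ xs
  passed⁻ xs = (- 1#) ^ suc (length xs) · pre (s ∷ []) (T⁻ xs)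

  -- Rewriting x t_s t⁺_{xs} (and x t_s t⁻_{xs}) is the next step after the
  -- reduction above has been multiplied by x on the left: isolate that part.
  rest⁺ : Fin n → List (Fin n) → Poly
  rest⁺ x xs = pre (x ∷ []) (δ xs · T⁻ xs) ⊕ (- q) · passed⁻ xs

  passed-layer⁺ : ∀ x xs → pre (x ∷ []) (passed⁺ xs) ⊕ (- q) · passed⁻ xs
                           ≡ pre (x ∷ s ∷ []) ((- 1#) ^ length xs · T⁺ xs) ⊕ rest⁺ x xs
  passed-layer⁺ x xs = ≡.trans (≡.cong (_⊕ (- q) · passed⁻ xs)
      (≡.trans (mapW-⊕ ((x ∷ []) ++_) (E · pre (s ∷ []) (T⁺ xs)) (δ xs · T⁻ xs))
        (≡.cong (_⊕ pre (x ∷ []) (δ xs · T⁻ xs))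
          (≡.trans (mapW-· ((x ∷ []) ++_) E (pre (s ∷ []) (T⁺ xs)))
            (≡.trans (≡.cong (E ·_) (pre-pre x (s ∷ []) (T⁺ xs))) (≡.sym (mapW-· ((x ∷ s ∷ []) ++_) E (T⁺ xs))))))))
    (⊕-assoc (pre (x ∷ s ∷ []) (E · T⁺ xs)) (pre (x ∷ []) (δ xs · T⁻ xs)) ((- q) · passed⁻ xs))
    where
    E : Carrier
    E = (- 1#) ^ length xs

  passed-layer⁻ : ∀ x xs → passed⁺ xs ⊕ (- 1#) · pre (x ∷ []) (passed⁻ xs)
                           ≃ pre (x ∷ s ∷ []) ((- 1#) ^ length xs · T⁻ xs) ⊕ passed⁺ xs
  passed-layer⁻ x xs = ≃-trans (⊕-comm (passed⁺ xs) _) (⊕-cong moved (≃-refl {passed⁺ xs}))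
    where
    E : Carrier
    E = (- 1#) ^ length xs
    moved : (- 1#) · pre (x ∷ []) (passed⁻ xs) ≃ pre (x ∷ s ∷ []) (E · T⁻ xs)
    moved = ≃-trans (≡⇒≃ (≡.cong ((- 1#) ·_) (≡.trans (mapW-· ((x ∷ []) ++_) ((- 1#) * E) (pre (s ∷ []) (T⁻ xs)))
                                                       (≡.cong ((- 1#) * E ·_) (pre-pre x (s ∷ []) (T⁻ xs))))))
              (≃-trans (≃-trans (·-assoc (- 1#) ((- 1#) * E) (pre (x ∷ s ∷ []) (T⁻ xs)))
                                (·-congˡ (pre (x ∷ s ∷ []) (T⁻ xs)) (solve 1 (λ E → :-one :* (:-one :* E) := E) refl E)))
                       (≡⇒≃ (≡.sym (mapW-· ((x ∷ s ∷ []) ++_) E (T⁻ xs)))))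

  passed⁺-head : ∀ xs {x} w → x ∉ xs → s ≢ x → coeff (passed⁺ xs) (x ∷ w) ≈ 0#
  passed⁺-head xs w x∉xs s≢x =
    c0+ ((- 1#) ^ length xs · pre (s ∷ []) (T⁺ xs)) (δ xs · T⁻ xs)
        (c0* _ (pre (s ∷ []) (T⁺ xs)) (coeff-pre-head (T⁺ xs) w s≢x))
        (c0* _ (T⁻ xs) (coeff-outside (T⁻ xs) (Words-T⁻ xs) _ (λ { (x∈xs ∷ _) → x∉xs x∈xs })))

  passed⁻-head : ∀ xs {x} w → s ≢ x → coeff (passed⁻ xs) (x ∷ w) ≈ 0#
  passed⁻-head xs w s≢x = c0* _ (pre (s ∷ []) (T⁻ xs)) (coeff-pre-head (T⁻ xs) w s≢x)

  swap-layer⁺ : ∀ x xs → ρ-swap s x ((- 1#) ^ length xs · T⁺ xs) ⊕ rest⁺ x xs ≃ passed⁺ (x ∷ xs)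
  swap-layer⁺ x xs = ⟪ go ⟫
    where
    E c₁ : Carrier
    E = (- 1#) ^ length xs
    c₁ = δ xs
    go : ∀ z → coeff (ρ-swap s x (E · T⁺ xs) ⊕ rest⁺ x xs) z ≈ coeff (passed⁺ (x ∷ xs)) z
    go z = begin
      coeff (ρ-swap s x (E · T⁺ xs) ⊕ rest⁺ x xs) z
        ≈⟨ c+ (ρ-swap s x (E · T⁺ xs)) (rest⁺ x xs)
             (c+ ((- 1#) · pre (s ∷ x ∷ []) (E · T⁺ xs)) ((two * q) · (E · T⁺ xs))
                 (c* (- 1#) (pre (s ∷ x ∷ []) (E · T⁺ xs)) (c≃ (≡⇒≃ (mapW-· ((s ∷ x ∷ []) ++_) E (T⁺ xs))) (coeff-· E (pre (s ∷ x ∷ []) (T⁺ xs)) z)))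
                 (c* (two * q) (E · T⁺ xs) (coeff-· E (T⁺ xs) z)))
             (c+ (pre (x ∷ []) (c₁ · T⁻ xs)) ((- q) · passed⁻ xs)
                 (c≃ (≡⇒≃ (mapW-· ((x ∷ []) ++_) c₁ (T⁻ xs))) (coeff-· c₁ (pre (x ∷ []) (T⁻ xs)) z))
                 (c* (- q) (passed⁻ xs) (coeff-· ((- 1#) ^ suc (length xs)) (pre (s ∷ []) (T⁻ xs)) z))) ⟩
      ((- 1#) * (E * A) + (two * q) * (E * B)) + (c₁ * C + (- q) * (((- 1#) ^ suc (length xs)) * D))
        ≈⟨ solve 6 (λ E Q A B C D →
               (:-one :* (E :* A) :+ (:two :* Q) :* (E :* B)) :+ (((:two :* (:-one :* E)) :* Q) :* C :+ (:- Q) :* ((:-one :* E) :* D))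
            := (:-one :* E) :* (A :+ (:- Q) :* D) :+ ((:two :* (:-one :* (:-one :* E))) :* Q) :* (B :+ :-one :* C))
            refl E q A B C D ⟩
      (- 1#) ^ suc (length xs) * (A + (- q) * D) + ((two * (- 1#) ^ suc (suc (length xs))) * q) * (B + (- 1#) * C)
        ≈⟨ sym (c+ ((- 1#) ^ suc (length xs) · pre (s ∷ []) (T⁺ (x ∷ xs))) (((two * (- 1#) ^ suc (suc (length xs))) * q) · T⁻ (x ∷ xs))
                   (c* _ (pre (s ∷ []) (T⁺ (x ∷ xs))) (coeff-pre-T⁺-cons s x xs z))
                   (c* _ (T⁻ (x ∷ xs)) (coeff-T⁻-cons x xs z))) ⟩
      coeff (passed⁺ (x ∷ xs)) z ∎
        where
        A B C D : Carrier
        A = coeff (pre (s ∷ x ∷ []) (T⁺ xs)) z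
        B = coeff (T⁺ xs) z
        C = coeff (pre (x ∷ []) (T⁻ xs)) z
        D = coeff (pre (s ∷ []) (T⁻ xs)) z

  swap-layer⁻ : ∀ x xs → ρ-swap s x ((- 1#) ^ length xs · T⁻ xs) ⊕ passed⁺ xs ≃ passed⁻ (x ∷ xs)
  swap-layer⁻ x xs = ⟪ go ⟫
    where
    E c₁ : Carrier
    E = (- 1#) ^ length xs
    c₁ = δ xs
    go : ∀ z → coeff (ρ-swap s x (E · T⁻ xs) ⊕ passed⁺ xs) z ≈ coeff (passed⁻ (x ∷ xs)) z
    go z = begin
      coeff (ρ-swap s x (E · T⁻ xs) ⊕ passed⁺ xs) z
        ≈⟨ c+ (ρ-swap s x (E · T⁻ xs)) (passed⁺ xs)
             (c+ ((- 1#) · pre (s ∷ x ∷ []) (E · T⁻ xs)) ((two * q) · (E · T⁻ xs))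
                 (c* (- 1#) (pre (s ∷ x ∷ []) (E · T⁻ xs)) (c≃ (≡⇒≃ (mapW-· ((s ∷ x ∷ []) ++_) E (T⁻ xs))) (coeff-· E (pre (s ∷ x ∷ []) (T⁻ xs)) z)))
                 (c* (two * q) (E · T⁻ xs) (coeff-· E (T⁻ xs) z)))
             (coeff-lin E (pre (s ∷ []) (T⁺ xs)) c₁ (T⁻ xs) z) ⟩
      ((- 1#) * (E * A) + (two * q) * (E * B)) + (E * P + c₁ * B)
        ≈⟨ solve 5 (λ E Q A B P →
               (:-one :* (E :* A) :+ (:two :* Q) :* (E :* B)) :+ (E :* P :+ ((:two :* (:-one :* E)) :* Q) :* B)
            := (:-one :* (:-one :* E)) :* (P :+ :-one :* A))
            refl E q A B P ⟩
      (- 1#) ^ suc (suc (length xs)) * (P + (- 1#) * A)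
        ≈⟨ sym (c* _ (pre (s ∷ []) (T⁻ (x ∷ xs))) (coeff-pre-T⁻-cons s x xs z)) ⟩
      coeff (passed⁻ (x ∷ xs)) z ∎
        where
        A B P : Carrier
        A = coeff (pre (s ∷ x ∷ []) (T⁻ xs)) z
        B = coeff (T⁻ xs) z
        P = coeff (pre (s ∷ []) (T⁺ xs)) z

  -- After the induction hypothesis, the words x t_s … are rewritten by one
  -- layer of the rule t_x t_s → -t_s t_x + 2q.
  move-past : ∀ xs → All (s <_) xs → Sorted xs →
              Red (Passing xs) (T⁺ xs ·tₛ) (passed⁺ xs) × Red (Passing xs) (T⁻ xs ·tₛ) (passed⁻ xs)
  move-past [] _ _ = red-refl (Pw⇒≃ ((sym (*-identityˡ _) , ≡.refl) ∷ [])) , red-refl ≃-refl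
  move-past (x ∷ xs) (s<x ∷ s<xs) (x<xs ∷ sorted) =
      red-≃ˡ (≃-sym (T⁺-cons-·tₛ x xs))
        (red-trans (red-weaken grow (proj₁ cons))
          (red-≃ˡ (≡⇒≃ (≡.sym (passed-layer⁺ x xs)))
            (red-≃ʳ (swap-layer⁺ x xs) (red-weaken into (layer (E · T⁺ xs) (Words-· E (T⁺ xs) (Words-T⁺ xs)) (rest⁺ x xs) K⁺≈0)))))
    , red-≃ˡ (≃-sym (T⁻-cons-·tₛ x xs))
        (red-trans (red-weaken grow (proj₂ cons))
          (red-≃ˡ (≃-sym (passed-layer⁻ x xs))
            (red-≃ʳ (swap-layer⁻ x xs) (red-weaken into (layer (E · T⁻ xs) (Words-· E (T⁻ xs) (Words-T⁻ xs)) (passed⁺ xs) K⁻≈0)))))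
    where
    E c₁ : Carrier
    E = (- 1#) ^ length xs
    c₁ = δ xs
    x∉xs : x ∉ xs
    x∉xs = ∉-above x<xs
    s∉xs : s ∉ xs
    s∉xs = ∉-above s<xs
    s≢x : s ≢ x
    s≢x = FinP.<⇒≢ s<x

    not-x : ∀ {w} w′ → Passing xs w → w ≢ x ∷ w′
    not-x w′ (y , _ , ≡.refl , y∈xs , _) e rewrite LP.∷-injectiveˡ e = x∉xs y∈xs

    cons : Red (Passing xs ∪ᵖ StartsWith x (Passing xs))
               (pre (x ∷ []) (T⁺ xs ·tₛ) ⊕ (- q) · T⁻ xs ·tₛ) (pre (x ∷ []) (passed⁺ xs) ⊕ (- q) · passed⁻ xs)
         × Red (Passing xs ∪ᵖ StartsWith x (Passing xs))
               (T⁺ xs ·tₛ ⊕ (- 1#) · pre (x ∷ []) (T⁻ xs ·tₛ)) (passed⁺ xs ⊕ (- 1#) · pre (x ∷ []) (passed⁻ xs))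
    cons = cons-step x not-x (proj₁ (move-past xs s<xs sorted)) (proj₂ (move-past xs s<xs sorted))
             (λ w _ → ·tₛ-head xs (T⁻ xs) (Words-T⁻ xs) w x∉xs (inj₁ (λ x≡s → s≢x (≡.sym x≡s))))
             (λ w _ → passed⁺-head xs w x∉xs s≢x)

    no-new-redex : ∀ w₁ w₂ → Letters xs w₁ → Letters xs w₂ → coeff (ρ-swap s x (mono w₁)) (x ∷ s ∷ w₂) ≈ 0#
    no-new-redex w₁ w₂ L₁ _ = c0+ ((- 1#) · pre (s ∷ x ∷ []) (mono w₁)) ((two * q) · mono w₁)
      (c0* (- 1#) (pre (s ∷ x ∷ []) (mono w₁)) (coeff-pre-outside (s ∷ x ∷ []) (mono w₁) _ (λ _ e → s≢x (LP.∷-injectiveˡ e))))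
      (c0* (two * q) (mono w₁) (coeff-mono-≢ w₁≢xsw₂))
      where
      w₁≢xsw₂ : w₁ ≢ x ∷ s ∷ w₂
      w₁≢xsw₂ ≡.refl = s∉xs (All.lookup L₁ (there (here ≡.refl)))

    open Layer (anti s x s<x) (ρ-swap s x) (ρ-swap-linear s x) (Letters xs) (swap-rewrite s x s<x) no-new-redex

    widen : Letters (s ∷ xs) ⊆ Letters (s ∷ x ∷ xs)
    widen = All.map λ { (here e) → here e ; (there y∈xs) → there (there y∈xs) }

    grow : Passing xs ∪ᵖ StartsWith x (Passing xs) ⊆ Passing (x ∷ xs)
    grow (inj₁ (y , w′ , e , y∈xs , L , s∈w′)) = y , w′ , e , there y∈xs , widen L , s∈w′
    grow (inj₂ (_ , ≡.refl , (y , w′ , ≡.refl , y∈xs , L , s∈w′))) =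
      x , y ∷ w′ , ≡.refl , here ≡.refl , there (there y∈xs) ∷ widen L , there s∈w′

    into : InLayer ⊆ Passing (x ∷ xs)
    into (w , ≡.refl , L) = x , s ∷ w , ≡.refl , here ≡.refl , here ≡.refl ∷ All.map (λ y∈xs → there (there y∈xs)) L , here ≡.refl

    K⁺≈0 : ∀ w → Letters xs w → coeff (rest⁺ x xs) (x ∷ s ∷ w) ≈ 0#
    K⁺≈0 w _ = c0+ (pre (x ∷ []) (c₁ · T⁻ xs)) ((- q) · passed⁻ xs)
      (trans (coeff-pre (x ∷ []) (c₁ · T⁻ xs) (s ∷ w))
             (c0* c₁ (T⁻ xs) (coeff-outside (T⁻ xs) (Words-T⁻ xs) (s ∷ w) (λ { (s∈xs ∷ _) → s∉xs s∈xs }))))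
      (c0* (- q) (passed⁻ xs) (passed⁻-head xs (s ∷ w) s≢x))

    K⁻≈0 : ∀ w → Letters xs w → coeff (passed⁺ xs) (x ∷ s ∷ w) ≈ 0#
    K⁻≈0 w _ = passed⁺-head xs (s ∷ w) x∉xs s≢x

module MainLemma {c ℓ} (R : CommutativeRing c ℓ) (n : ℕ) (q : CommutativeRing.Carrier R) (s : Fin n) where
  open import Data.List.Membership.Propositional using (_∈_; _∉_)
  open CommutativeRing R
  open Alg R n q
  open Polynomials R n q
  open Reductions R n q
  open Expansions R n q
  open Layers R n q
  open Moves R n q s
  open IntegerSolver R
  open import Relation.Binary.Reasoning.Setoid setoid

  out⁺ out⁻ in⁺ in⁻ : List (Fin n) → Poly
  out⁺ js = (- 1#) ^ above s js · T⁺ (insert s js) ⊕ ((- 1#) ^ suc (length js) * q) · T⁻ js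
  out⁻ js = (- 1#) ^ above s js · T⁻ (insert s js) ⊕ (- 1#) ^ suc (length js) · T⁺ js
  in⁺ js = ((- 1#) ^ suc (length js) * q) · T⁻ js
  in⁻ js = (- 1#) ^ suc (length js) · T⁺ js

  passed-out⁺ : ∀ js → All (s <_) js → passed⁺ js ≃ out⁺ js
  passed-out⁺ js s<js rewrite insert-least js s<js | above-all js s<js = ⟪ go ⟫
    where
    go : ∀ z → coeff (passed⁺ js) z ≈ coeff ((- 1#) ^ length js · T⁺ (s ∷ js) ⊕ ((- 1#) ^ suc (length js) * q) · T⁻ js) z
    go z = trans (coeff-lin ((- 1#) ^ length js) (pre (s ∷ []) (T⁺ js)) (δ js) (T⁻ js) z)
      (trans (solve 4 (λ E Q P B → E :* P :+ ((:two :* (:-one :* E)) :* Q) :* B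
                                 := E :* (P :+ (:- Q) :* B) :+ ((:-one :* E) :* Q) :* B)
                      refl ((- 1#) ^ length js) q (coeff (pre (s ∷ []) (T⁺ js)) z) (coeff (T⁻ js) z))
             (sym (trans (coeff-lin _ (T⁺ (s ∷ js)) _ (T⁻ js) z) (+-congʳ (*-congˡ (coeff-T⁺-cons s js z))))))

  passed-out⁻ : ∀ js → All (s <_) js → passed⁻ js ≃ out⁻ js
  passed-out⁻ js s<js rewrite insert-least js s<js | above-all js s<js = ⟪ go ⟫
    where
    go : ∀ z → coeff (passed⁻ js) z ≈ coeff ((- 1#) ^ length js · T⁻ (s ∷ js) ⊕ (- 1#) ^ suc (length js) · T⁺ js) z
    go z = trans (coeff-· ((- 1#) ^ suc (length js)) (pre (s ∷ []) (T⁻ js)) z)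
      (trans (solve 3 (λ E D B → (:-one :* E) :* D := E :* (B :+ :-one :* D) :+ (:-one :* E) :* B)
                      refl ((- 1#) ^ length js) (coeff (pre (s ∷ []) (T⁻ js)) z) (coeff (T⁺ js) z))
             (sym (trans (coeff-lin _ (T⁻ (s ∷ js)) _ (T⁺ js) z) (+-congʳ (*-congˡ (coeff-T⁻-cons s js z))))))

  out⁺-head : ∀ xs {x} w → x ∉ xs → x ≢ s → coeff (out⁺ xs) (x ∷ w) ≈ 0#
  out⁺-head xs w x∉xs x≢s =
    c0+ ((- 1#) ^ above s xs · T⁺ (insert s xs)) (((- 1#) ^ suc (length xs) * q) · T⁻ xs)
        (c0* _ (T⁺ (insert s xs)) (coeff-outside (T⁺ (insert s xs)) (Words-T⁺ (insert s xs)) _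
                                                  (λ { (x∈ ∷ _) → ∉-insert xs x∉xs x≢s x∈ })))
        (c0* _ (T⁻ xs) (coeff-outside (T⁻ xs) (Words-T⁻ xs) _ (λ { (x∈xs ∷ _) → x∉xs x∈xs })))

  Passing⊆Letters : ∀ xs → Passing xs ⊆ Letters (s ∷ xs)
  Passing⊆Letters xs (_ , _ , ≡.refl , y∈xs , L , _) = there y∈xs ∷ L

  not-letter : ∀ {js x} → x ∉ js → ∀ {w} w′ → Letters js w → w ≢ x ∷ w′
  not-letter x∉js w′ (x∈js ∷ _) ≡.refl = x∉js x∈js

  grow : ∀ x xs → Letters (s ∷ xs) ∪ᵖ StartsWith x (Letters (s ∷ xs)) ⊆ Letters (s ∷ x ∷ xs)
  grow x xs (inj₁ L) = All.map widen L
    where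
    widen : ∀ {a} → a ∈ s ∷ xs → a ∈ s ∷ x ∷ xs
    widen (here e) = here e
    widen (there a∈xs) = there (there a∈xs)
  grow x xs (inj₂ (_ , ≡.refl , L)) = there (here ≡.refl) ∷ grow x xs (inj₁ L)

  out-cons⁺ : ∀ x xs → x < s → pre (x ∷ []) (out⁺ xs) ⊕ (- q) · out⁻ xs ≃ out⁺ (x ∷ xs)
  out-cons⁺ x xs x<s rewrite insert-skip xs (λ s<x → FinP.<-asym s<x x<s) | above-skip xs x<s = ⟪ go ⟫
    where
    F E : Carrier
    F = (- 1#) ^ above s xs
    E = (- 1#) ^ length xs
    I : List (Fin n)
    I = insert s xs
    go : ∀ z → coeff (pre (x ∷ []) (out⁺ xs) ⊕ (- q) · out⁻ xs) z
               ≈ coeff (F · T⁺ (x ∷ I) ⊕ ((- 1#) ^ suc (suc (length xs)) * q) · T⁻ (x ∷ xs)) z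
    go z = begin
      coeff (pre (x ∷ []) (out⁺ xs) ⊕ (- q) · out⁻ xs) z
        ≈⟨ c+ (pre (x ∷ []) (out⁺ xs)) ((- q) · out⁻ xs)
              (c≃ (≡⇒≃ (mapW-lin ((x ∷ []) ++_) F (T⁺ I) ((- 1#) ^ suc (length xs) * q) (T⁻ xs)))
                  (coeff-lin F (pre (x ∷ []) (T⁺ I)) _ (pre (x ∷ []) (T⁻ xs)) z))
              (c* (- q) (out⁻ xs) (coeff-lin F (T⁻ I) _ (T⁺ xs) z)) ⟩
      (F * A + ((- 1#) * E * q) * C) + (- q) * (F * B + ((- 1#) * E) * D)
        ≈⟨ solve 7 (λ F E Q A B C D → (F :* A :+ ((:-one :* E) :* Q) :* C) :+ (:- Q) :* (F :* B :+ (:-one :* E) :* D)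
                                    := F :* (A :+ (:- Q) :* B) :+ ((:-one :* (:-one :* E)) :* Q) :* (D :+ :-one :* C))
                   refl F E q A B C D ⟩
      F * (A + (- q) * B) + ((- 1#) * ((- 1#) * E) * q) * (D + (- 1#) * C)
        ≈⟨ sym (trans (coeff-lin F (T⁺ (x ∷ I)) _ (T⁻ (x ∷ xs)) z)
                      (+-cong (*-congˡ (coeff-T⁺-cons x I z)) (*-congˡ (coeff-T⁻-cons x xs z)))) ⟩
      coeff (F · T⁺ (x ∷ I) ⊕ ((- 1#) ^ suc (suc (length xs)) * q) · T⁻ (x ∷ xs)) z ∎
      where
      A B C D : Carrier
      A = coeff (pre (x ∷ []) (T⁺ I)) z
      B = coeff (T⁻ I) z
      C = coeff (pre (x ∷ []) (T⁻ xs)) z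
      D = coeff (T⁺ xs) z
  out-cons⁻ : ∀ x xs → x < s → out⁺ xs ⊕ (- 1#) · pre (x ∷ []) (out⁻ xs) ≃ out⁻ (x ∷ xs)
  out-cons⁻ x xs x<s rewrite insert-skip xs (λ s<x → FinP.<-asym s<x x<s) | above-skip xs x<s = ⟪ go ⟫
    where
    F E : Carrier
    F = (- 1#) ^ above s xs
    E = (- 1#) ^ length xs
    I : List (Fin n)
    I = insert s xs
    go : ∀ z → coeff (out⁺ xs ⊕ (- 1#) · pre (x ∷ []) (out⁻ xs)) z
               ≈ coeff (F · T⁻ (x ∷ I) ⊕ (- 1#) ^ suc (suc (length xs)) · T⁺ (x ∷ xs)) z
    go z = begin
      coeff (out⁺ xs ⊕ (- 1#) · pre (x ∷ []) (out⁻ xs)) z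
        ≈⟨ c+ (out⁺ xs) ((- 1#) · pre (x ∷ []) (out⁻ xs))
              (coeff-lin F (T⁺ I) _ (T⁻ xs) z)
              (c* (- 1#) (pre (x ∷ []) (out⁻ xs))
                  (c≃ (≡⇒≃ (mapW-lin ((x ∷ []) ++_) F (T⁻ I) ((- 1#) ^ suc (length xs)) (T⁺ xs)))
                      (coeff-lin F (pre (x ∷ []) (T⁻ I)) _ (pre (x ∷ []) (T⁺ xs)) z))) ⟩
      (F * A + ((- 1#) * E * q) * C) + (- 1#) * (F * B + ((- 1#) * E) * D)
        ≈⟨ solve 7 (λ F E Q A B C D → (F :* A :+ ((:-one :* E) :* Q) :* C) :+ :-one :* (F :* B :+ (:-one :* E) :* D)
                                    := F :* (A :+ :-one :* B) :+ (:-one :* (:-one :* E)) :* (D :+ (:- Q) :* C))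
                   refl F E q A B C D ⟩
      F * (A + (- 1#) * B) + ((- 1#) * ((- 1#) * E)) * (D + (- q) * C)
        ≈⟨ sym (trans (coeff-lin F (T⁻ (x ∷ I)) _ (T⁺ (x ∷ xs)) z)
                      (+-cong (*-congˡ (coeff-T⁻-cons x I z)) (*-congˡ (coeff-T⁺-cons x xs z)))) ⟩
      coeff (F · T⁻ (x ∷ I) ⊕ (- 1#) ^ suc (suc (length xs)) · T⁺ (x ∷ xs)) z ∎
      where
      A B C D : Carrier
      A = coeff (T⁺ I) z
      B = coeff (pre (x ∷ []) (T⁻ I)) z
      C = coeff (T⁻ xs) z
      D = coeff (pre (x ∷ []) (T⁺ xs)) z

  -- Letters below s are split off by cons-step; once the head exceeds s,
  -- the whole list is above s and move-past applies.
  reduce-out : ∀ js → Sorted js → s ∉ js →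
               Red (Letters (s ∷ js)) (T⁺ js ·tₛ) (out⁺ js) × Red (Letters (s ∷ js)) (T⁻ js ·tₛ) (out⁻ js)
  reduce-out [] _ _ = red-refl (Pw⇒≃ ((sym (*-identityˡ _) , ≡.refl) ∷ [])) , red-refl out⁻-[]
    where
    out⁻-[] : [] ≃ out⁻ []
    out⁻-[] = ⟪ (λ z → sym (trans (coeff-lin 1# (T⁻ (s ∷ [])) (- 1# * 1#) (T⁺ []) z)
                 (trans (+-congˡ (*-congˡ (sym (un (Pw⇒≃ {T⁻ (s ∷ [])} {T⁺ []} ((refl , ≡.refl) ∷ [])) z))))
                        (solve 1 (λ A → :one :* A :+ (:-one :* :one) :* A := :zero) refl _)))) ⟫
  reduce-out js@(x ∷ xs) (x<xs ∷ sorted) s∉js with FinP.<-cmp s x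
  ... | tri≈ _ s≡x _ = ⊥-elim (s∉js (here s≡x))
  ... | tri< s<x _ _ = red-weaken (Passing⊆Letters js) (red-≃ʳ (passed-out⁺ js s<js) (proj₁ (move-past js s<js (x<xs ∷ sorted))))
                     , red-weaken (Passing⊆Letters js) (red-≃ʳ (passed-out⁻ js s<js) (proj₂ (move-past js s<js (x<xs ∷ sorted))))
    where
    s<js : All (s <_) js
    s<js = s<x ∷ All.map (FinP.<-trans s<x) x<xs
  ... | tri> _ _ x<s = red-≃ˡ (≃-sym (T⁺-cons-·tₛ x xs)) (red-≃ʳ (out-cons⁺ x xs x<s) (red-weaken (grow x xs) (proj₁ cons)))
                     , red-≃ˡ (≃-sym (T⁻-cons-·tₛ x xs)) (red-≃ʳ (out-cons⁻ x xs x<s) (red-weaken (grow x xs) (proj₂ cons)))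
    where
    x∉xs : x ∉ xs
    x∉xs = ∉-above x<xs
    x≢s : x ≢ s
    x≢s = FinP.<⇒≢ x<s
    IH : Red (Letters (s ∷ xs)) (T⁺ xs ·tₛ) (out⁺ xs) × Red (Letters (s ∷ xs)) (T⁻ xs ·tₛ) (out⁻ xs)
    IH = reduce-out xs sorted (λ s∈xs → s∉js (there s∈xs))
    cons : Red (Letters (s ∷ xs) ∪ᵖ StartsWith x (Letters (s ∷ xs)))
               (pre (x ∷ []) (T⁺ xs ·tₛ) ⊕ (- q) · T⁻ xs ·tₛ) (pre (x ∷ []) (out⁺ xs) ⊕ (- q) · out⁻ xs)
         × Red (Letters (s ∷ xs) ∪ᵖ StartsWith x (Letters (s ∷ xs)))
               (T⁺ xs ·tₛ ⊕ (- 1#) · pre (x ∷ []) (T⁻ xs ·tₛ)) (out⁺ xs ⊕ (- 1#) · pre (x ∷ []) (out⁻ xs))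
    cons = cons-step x (not-letter λ { (here x≡s) → x≢s x≡s ; (there x∈xs) → x∉xs x∈xs })
             (proj₁ IH) (proj₂ IH)
             (λ w _ → ·tₛ-head xs (T⁻ xs) (Words-T⁻ xs) w x∉xs (inj₁ x≢s))
             (λ w _ → out⁺-head xs w x∉xs x≢s)

  in⁺-head : ∀ xs {x} w → x ∉ xs → coeff (in⁺ xs) (x ∷ w) ≈ 0#
  in⁺-head xs w x∉xs = c0* _ (T⁻ xs) (coeff-outside (T⁻ xs) (Words-T⁻ xs) _ (λ { (x∈xs ∷ _) → x∉xs x∈xs }))

  in-cons⁺ : ∀ x xs → pre (x ∷ []) (in⁺ xs) ⊕ (- q) · in⁻ xs ≃ in⁺ (x ∷ xs)
  in-cons⁺ x xs = ⟪ go ⟫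
    where
    E : Carrier
    E = (- 1#) ^ length xs
    go : ∀ z → coeff (pre (x ∷ []) (in⁺ xs) ⊕ (- q) · in⁻ xs) z ≈ coeff (in⁺ (x ∷ xs)) z
    go z = trans (c+ (pre (x ∷ []) (in⁺ xs)) ((- q) · in⁻ xs)
                     (c≃ (≡⇒≃ (mapW-· ((x ∷ []) ++_) ((- 1#) ^ suc (length xs) * q) (T⁻ xs)))
                         (coeff-· _ (pre (x ∷ []) (T⁻ xs)) z))
                     (c* (- q) (in⁻ xs) (coeff-· _ (T⁺ xs) z)))
      (trans (solve 4 (λ E Q C D → ((:-one :* E) :* Q) :* C :+ (:- Q) :* ((:-one :* E) :* D)
                                 := ((:-one :* (:-one :* E)) :* Q) :* (D :+ :-one :* C))
                      refl E q (coeff (pre (x ∷ []) (T⁻ xs)) z) (coeff (T⁺ xs) z))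
             (sym (c* _ (T⁻ (x ∷ xs)) (coeff-T⁻-cons x xs z))))

  in-cons⁻ : ∀ x xs → in⁺ xs ⊕ (- 1#) · pre (x ∷ []) (in⁻ xs) ≃ in⁻ (x ∷ xs)
  in-cons⁻ x xs = ⟪ go ⟫
    where
    E : Carrier
    E = (- 1#) ^ length xs
    go : ∀ z → coeff (in⁺ xs ⊕ (- 1#) · pre (x ∷ []) (in⁻ xs)) z ≈ coeff (in⁻ (x ∷ xs)) z
    go z = trans (c+ (in⁺ xs) ((- 1#) · pre (x ∷ []) (in⁻ xs))
                     (coeff-· _ (T⁻ xs) z)
                     (c* (- 1#) (pre (x ∷ []) (in⁻ xs))
                         (c≃ (≡⇒≃ (mapW-· ((x ∷ []) ++_) ((- 1#) ^ suc (length xs)) (T⁺ xs))) (coeff-· _ (pre (x ∷ []) (T⁺ xs)) z))))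
      (trans (solve 4 (λ E Q B A → ((:-one :* E) :* Q) :* B :+ :-one :* ((:-one :* E) :* A)
                                 := (:-one :* (:-one :* E)) :* (A :+ (:- Q) :* B))
                      refl E q (coeff (T⁻ xs) z) (coeff (pre (x ∷ []) (T⁺ xs)) z))
             (sym (c* _ (T⁺ (x ∷ xs)) (coeff-T⁺-cons x xs z))))

  passed⁺-at-s : ∀ xs → s ∉ xs → ∀ w → ¬ Letters xs w → coeff (passed⁺ xs) (s ∷ w) ≈ 0#
  passed⁺-at-s xs s∉xs w ¬L =
    c0+ ((- 1#) ^ length xs · pre (s ∷ []) (T⁺ xs)) (δ xs · T⁻ xs)
        (c0* _ (pre (s ∷ []) (T⁺ xs)) (trans (coeff-pre (s ∷ []) (T⁺ xs) w) (coeff-outside (T⁺ xs) (Words-T⁺ xs) w ¬L)))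
        (c0* _ (T⁻ xs) (coeff-outside (T⁻ xs) (Words-T⁻ xs) (s ∷ w) (λ { (s∈xs ∷ _) → s∉xs s∈xs })))

  square-layer⁺ : ∀ xs → ρ-square ((- 1#) ^ length xs · T⁺ xs) ⊕ rest⁺ s xs ≃ in⁺ (s ∷ xs)
  square-layer⁺ xs = ⟪ go ⟫
    where
    E : Carrier
    E = (- 1#) ^ length xs
    go : ∀ z → coeff (ρ-square (E · T⁺ xs) ⊕ rest⁺ s xs) z ≈ coeff (in⁺ (s ∷ xs)) z
    go z = trans (c+ (ρ-square (E · T⁺ xs)) (rest⁺ s xs) (c* q (E · T⁺ xs) (coeff-· E (T⁺ xs) z))
                     (c+ (pre (s ∷ []) (δ xs · T⁻ xs)) ((- q) · passed⁻ xs)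
                         (c≃ (≡⇒≃ (mapW-· ((s ∷ []) ++_) (δ xs) (T⁻ xs))) (coeff-· (δ xs) (pre (s ∷ []) (T⁻ xs)) z))
                         (c* (- q) (passed⁻ xs) (coeff-· _ (pre (s ∷ []) (T⁻ xs)) z))))
      (trans (solve 4 (λ E Q B C → Q :* (E :* B) :+ (((:two :* (:-one :* E)) :* Q) :* C :+ (:- Q) :* ((:-one :* E) :* C))
                                 := ((:-one :* (:-one :* E)) :* Q) :* (B :+ :-one :* C))
                      refl E q (coeff (T⁺ xs) z) (coeff (pre (s ∷ []) (T⁻ xs)) z))
             (sym (c* _ (T⁻ (s ∷ xs)) (coeff-T⁻-cons s xs z))))

  square-layer⁻ : ∀ xs → ρ-square ((- 1#) ^ length xs · T⁻ xs) ⊕ passed⁺ xs ≃ in⁻ (s ∷ xs)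
  square-layer⁻ xs = ⟪ go ⟫
    where
    E : Carrier
    E = (- 1#) ^ length xs
    go : ∀ z → coeff (ρ-square (E · T⁻ xs) ⊕ passed⁺ xs) z ≈ coeff (in⁻ (s ∷ xs)) z
    go z = trans (c+ (ρ-square (E · T⁻ xs)) (passed⁺ xs) (c* q (E · T⁻ xs) (coeff-· E (T⁻ xs) z))
                     (coeff-lin E (pre (s ∷ []) (T⁺ xs)) (δ xs) (T⁻ xs) z))
      (trans (solve 4 (λ E Q B P → Q :* (E :* B) :+ (E :* P :+ ((:two :* (:-one :* E)) :* Q) :* B)
                                 := (:-one :* (:-one :* E)) :* (P :+ (:- Q) :* B))
                      refl E q (coeff (T⁻ xs) z) (coeff (pre (s ∷ []) (T⁺ xs)) z))
             (sym (c* _ (T⁺ (s ∷ xs)) (coeff-T⁺-cons s xs z))))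

  -- Case J = s ∷ xs with s below xs: t_s moves past xs (move-past), then the
  -- layer t_s t_s → q absorbs it.
  reduce-at-s : ∀ xs → All (s <_) xs → Sorted xs →
                Red (Letters (s ∷ s ∷ xs)) (T⁺ (s ∷ xs) ·tₛ) (in⁺ (s ∷ xs))
              × Red (Letters (s ∷ s ∷ xs)) (T⁻ (s ∷ xs) ·tₛ) (in⁻ (s ∷ xs))
  reduce-at-s xs s<xs sorted =
      red-≃ˡ (≃-sym (T⁺-cons-·tₛ s xs))
        (red-trans (red-weaken grow-passing (proj₁ cons))
          (red-≃ˡ (≡⇒≃ (≡.sym (passed-layer⁺ s xs)))
            (red-≃ʳ (square-layer⁺ xs) (red-weaken into (layer (E · T⁺ xs) (Words-· E (T⁺ xs) (Words-T⁺ xs)) (rest⁺ s xs) rest⁺≈0)))))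
    , red-≃ˡ (≃-sym (T⁻-cons-·tₛ s xs))
        (red-trans (red-weaken grow-passing (proj₂ cons))
          (red-≃ˡ (≃-sym (passed-layer⁻ s xs))
            (red-≃ʳ (square-layer⁻ xs) (red-weaken into (layer (E · T⁻ xs) (Words-· E (T⁻ xs) (Words-T⁻ xs)) (passed⁺ xs) passed⁺≈0)))))
    where
    E : Carrier
    E = (- 1#) ^ length xs
    s∉xs : s ∉ xs
    s∉xs = ∉-above s<xs
    not-s : ∀ {w} w′ → Passing xs w → w ≢ s ∷ w′
    not-s w′ (_ , _ , ≡.refl , y∈xs , _) e rewrite LP.∷-injectiveˡ e = s∉xs y∈xs
    passing-not-letters : ∀ {w} → Passing xs w → ¬ Letters xs w
    passing-not-letters (_ , _ , ≡.refl , _ , _ , s∈w′) (_ ∷ L) = s∉xs (All.lookup L s∈w′)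
    cons : Red (Passing xs ∪ᵖ StartsWith s (Passing xs))
               (pre (s ∷ []) (T⁺ xs ·tₛ) ⊕ (- q) · T⁻ xs ·tₛ) (pre (s ∷ []) (passed⁺ xs) ⊕ (- q) · passed⁻ xs)
         × Red (Passing xs ∪ᵖ StartsWith s (Passing xs))
               (T⁺ xs ·tₛ ⊕ (- 1#) · pre (s ∷ []) (T⁻ xs ·tₛ)) (passed⁺ xs ⊕ (- 1#) · pre (s ∷ []) (passed⁻ xs))
    cons = cons-step s not-s (proj₁ (move-past xs s<xs sorted)) (proj₂ (move-past xs s<xs sorted))
             (λ { w (y , w′ , ≡.refl , _) → ·tₛ-head xs (T⁻ xs) (Words-T⁻ xs) (y ∷ w′) s∉xs (inj₂ λ ()) })
             (λ w Pw → passed⁺-at-s xs s∉xs w (passing-not-letters Pw))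

    no-new-redex : ∀ w₁ w₂ → Letters xs w₁ → Letters xs w₂ → coeff (ρ-square (mono w₁)) (s ∷ s ∷ w₂) ≈ 0#
    no-new-redex w₁ w₂ L₁ _ = c0* q (mono w₁) (coeff-mono-≢ λ { ≡.refl → s∉xs (All.head L₁) })

    open Layer (sq s) ρ-square ρ-square-linear (Letters xs) (square-rewrite s) no-new-redex

    grow-passing : Passing xs ∪ᵖ StartsWith s (Passing xs) ⊆ Letters (s ∷ s ∷ xs)
    grow-passing (inj₁ Pw) = All.map there (Passing⊆Letters xs Pw)
    grow-passing (inj₂ (_ , ≡.refl , Pw)) = here ≡.refl ∷ All.map there (Passing⊆Letters xs Pw)

    into : InLayer ⊆ Letters (s ∷ s ∷ xs)
    into (w , ≡.refl , L) = here ≡.refl ∷ here ≡.refl ∷ All.map (λ y∈xs → there (there y∈xs)) L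

    rest⁺≈0 : ∀ w → Letters xs w → coeff (rest⁺ s xs) (s ∷ s ∷ w) ≈ 0#
    rest⁺≈0 w _ = c0+ (pre (s ∷ []) (δ xs · T⁻ xs)) ((- q) · passed⁻ xs)
      (trans (coeff-pre (s ∷ []) (δ xs · T⁻ xs) (s ∷ w)) (c0* (δ xs) (T⁻ xs) T⁻-at-sw))
      (c0* (- q) (passed⁻ xs) (c0* _ (pre (s ∷ []) (T⁻ xs)) (trans (coeff-pre (s ∷ []) (T⁻ xs) (s ∷ w)) T⁻-at-sw)))
      where
      T⁻-at-sw : coeff (T⁻ xs) (s ∷ w) ≈ 0#
      T⁻-at-sw = coeff-outside (T⁻ xs) (Words-T⁻ xs) (s ∷ w) (λ { (s∈xs ∷ _) → s∉xs s∈xs })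

    passed⁺≈0 : ∀ w → Letters xs w → coeff (passed⁺ xs) (s ∷ s ∷ w) ≈ 0#
    passed⁺≈0 w _ = passed⁺-at-s xs s∉xs (s ∷ w) (λ { (s∈xs ∷ _) → s∉xs s∈xs })

  -- Case s ∈ J:  t⁺_J t_s → (-1)^{#J+1} q t⁻_J  and  t⁻_J t_s → (-1)^{#J+1} t⁺_J.
  -- Letters below s are split off by cons-step until s is the first letter.
  reduce-in : ∀ js → Sorted js → s ∈ js →
              Red (Letters (s ∷ js)) (T⁺ js ·tₛ) (in⁺ js) × Red (Letters (s ∷ js)) (T⁻ js ·tₛ) (in⁻ js)
  reduce-in [] _ ()
  reduce-in (x ∷ xs) (x<xs ∷ sorted) s∈js with FinP.<-cmp s x | s∈js
  ... | tri< s<x _ _ | here s≡x = ⊥-elim (FinP.<⇒≢ s<x s≡x)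
  ... | tri< s<x _ _ | there s∈xs = ⊥-elim (FinP.<-asym s<x (All.lookup x<xs s∈xs))
  ... | tri> _ _ x<s | here s≡x = ⊥-elim (FinP.<⇒≢ x<s (≡.sym s≡x))
  ... | tri> _ _ x<s | there s∈xs =
        red-≃ˡ (≃-sym (T⁺-cons-·tₛ x xs)) (red-≃ʳ (in-cons⁺ x xs) (red-weaken (grow x xs) (proj₁ cons)))
      , red-≃ˡ (≃-sym (T⁻-cons-·tₛ x xs)) (red-≃ʳ (in-cons⁻ x xs) (red-weaken (grow x xs) (proj₂ cons)))
    where
    x∉xs : x ∉ xs
    x∉xs = ∉-above x<xs
    x≢s : x ≢ s
    x≢s = FinP.<⇒≢ x<s
    IH : Red (Letters (s ∷ xs)) (T⁺ xs ·tₛ) (in⁺ xs) × Red (Letters (s ∷ xs)) (T⁻ xs ·tₛ) (in⁻ xs)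
    IH = reduce-in xs sorted s∈xs
    cons : Red (Letters (s ∷ xs) ∪ᵖ StartsWith x (Letters (s ∷ xs)))
               (pre (x ∷ []) (T⁺ xs ·tₛ) ⊕ (- q) · T⁻ xs ·tₛ) (pre (x ∷ []) (in⁺ xs) ⊕ (- q) · in⁻ xs)
         × Red (Letters (s ∷ xs) ∪ᵖ StartsWith x (Letters (s ∷ xs)))
               (T⁺ xs ·tₛ ⊕ (- 1#) · pre (x ∷ []) (T⁻ xs ·tₛ)) (in⁺ xs ⊕ (- 1#) · pre (x ∷ []) (in⁻ xs))
    cons = cons-step x (not-letter λ { (here x≡s) → x≢s x≡s ; (there x∈xs) → x∉xs x∈xs })
             (proj₁ IH) (proj₂ IH)
             (λ w _ → ·tₛ-head xs (T⁻ xs) (Words-T⁻ xs) w x∉xs (inj₁ x≢s))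
             (λ w _ → in⁺-head xs w x∉xs)
  ... | tri≈ _ ≡.refl _ | _ = reduce-at-s xs x<xs sorted

open import Data.Fin.Subset using (Subset; _∈_; _∉_; _∪_; ⁅_⁆; ∣_∣)

module Theorem {c ℓ} (R : CommutativeRing c ℓ) (n : ℕ) (q : CommutativeRing.Carrier R) (J : Subset n) (s : Fin n) where
  open CommutativeRing R
  open Alg R n q
  open Polynomials R n q
  open Reductions R n q
  open Expansions R n q
  open Moves R n q s
  open MainLemma R n q s

  js : List (Fin n)
  js = elems J

  from-lists : ∀ {P h⁺ h⁻ H⁺ H⁻} → Red P (T⁺ js ·tₛ) h⁺ × Red P (T⁻ js ·tₛ) h⁻ → h⁺ ≡ H⁺ → h⁻ ≡ H⁻ →
               (t⁺ J ⊛ var s ⟶* H⁺) × (t⁻ J ⊛ var s ⟶* H⁻)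
  from-lists (r⁺ , r⁻) ≡.refl ≡.refl = Red⇒⟶* (red-≃ˡ (≃-sym (⊛mono (T⁺ js) (s ∷ []))) r⁺)
                                     , Red⇒⟶* (red-≃ˡ (≃-sym (⊛mono (T⁻ js) (s ∷ []))) r⁻)

  case-∈ : s ∈ J → (t⁺ J ⊛ var s ⟶* ((((- 1#) ^ suc ∣ J ∣) * q) · t⁻ J))
                 × (t⁻ J ⊛ var s ⟶* (((- 1#) ^ suc ∣ J ∣) · t⁺ J))
  case-∈ s∈J = from-lists (reduce-in js (elems-sorted J) (elems-∈ s∈J))
    (≡.cong (λ m → (((- 1#) ^ suc m) * q) · T⁻ js) (≡.sym (∣∣≡length J)))
    (≡.cong (λ m → ((- 1#) ^ suc m) · T⁺ js) (≡.sym (∣∣≡length J)))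

  case-∉ : s ∉ J → (t⁺ J ⊛ var s ⟶* (((- 1#) ^ #above s J) · t⁺ (J ∪ ⁅ s ⁆) ⊕ (((- 1#) ^ suc ∣ J ∣) * q) · t⁻ J))
                 × (t⁻ J ⊛ var s ⟶* (((- 1#) ^ #above s J) · t⁻ (J ∪ ⁅ s ⁆) ⊕ ((- 1#) ^ suc ∣ J ∣) · t⁺ J))
  case-∉ s∉J = from-lists (reduce-out js (elems-sorted J) (λ s∈js → s∉J (elems-∈⁻ J s∈js)))
    (≡.cong₂ (λ K m → ((- 1#) ^ above s js) · T⁺ K ⊕ (((- 1#) ^ suc m) * q) · T⁻ js)
             (≡.sym (elems-∪ s J s∉J)) (≡.sym (∣∣≡length J)))
    (≡.cong₂ (λ K m → ((- 1#) ^ above s js) · T⁻ K ⊕ ((- 1#) ^ suc m) · T⁺ js)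
             (≡.sym (elems-∪ s J s∉J)) (≡.sym (∣∣≡length J)))

lemma3p7 : ∀ {c ℓ : Level} (R : CommutativeRing c ℓ) (n : ℕ) (q : CommutativeRing.Carrier R)
             (J : Subset n) (s : Fin n) →
           let open CommutativeRing R
               open Alg R n q
           in (s ∈ J →
                 (t⁺ J ⊛ var s ⟶* ((((- 1#) ^ suc ∣ J ∣) * q) · t⁻ J))
               × (t⁻ J ⊛ var s ⟶* (((- 1#) ^ suc ∣ J ∣) · t⁺ J)))
            × (s ∉ J →
                 (t⁺ J ⊛ var s ⟶* (((- 1#) ^ #above s J) · t⁺ (J ∪ ⁅ s ⁆)
                                    ⊕ (((- 1#) ^ suc ∣ J ∣) * q) · t⁻ J))
               × (t⁻ J ⊛ var s ⟶* (((- 1#) ^ #above s J) · t⁻ (J ∪ ⁅ s ⁆)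
                                    ⊕ ((- 1#) ^ suc ∣ J ∣) · t⁺ J)))
lemma3p7 R n q J s = Theorem.case-∈ R n q J s , Theorem.case-∉ R n q J s
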